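{- For every $n\ge 1$, the map $\pi\mapsto D_-^B(\pi)$ is injective on $B_n$; that is, if $\pi,\sigma\in B_n$ satisfy $D_-^B(\pi)=D_-^B(\sigma)$, then $\pi=\sigma$.
   Context: $B_n$ is the group of permutations $\pi$ of $[-n,n]\setminus\{0\}$ satisfying $\pi(-i)=-\pi(i)$ for all $i$. Let $\ell(\pi)$ be the length of $\pi$ with respect to the Coxeter generators $s_0=t_{1,-1}$ and $s_i=t_{i,i+1}t_{ -i,-(i+1)}$, $i\in[1,n-1]$, where $t_{x,y}$ denotes the transposition interchanging $x$ and $y$. For $\pi\in B_n$ and distinct $a,b\in[-n,n]\setminus\{0\}$ define $u_{a,b}=u_{b,a}=u_{ -a,-b}$ as follows: if $a=-b$ then $u_{a,b}=t_{a,-a}$; if $ab>0$ or $\pi^{ -1}(a)\pi^{ -1}(b)>0$ then $u_{a,b}=t_{a,b}t_{ -a,-b}$; otherwise ($a\neq -b$, $ab<0$ and $\pi^{ -1}(a)\pi^{ -1}(b)<0$) $u_{a,b}$ is undefined. The strong $B$-descent set of $\pi$ is $D_-^B(\pi)=\{u_{a,b}\ \text{defined}:\ \ell(u_{a,b}\pi)=\ell(\pi)-1\}$, a set of elements of $B_n$. -}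

module Defs where

open import Data.Nat using (ℕ; zero; suc; _≤_)
open import Data.Bool using (Bool; true; false; not; if_then_else_)
import Data.Bool.Properties as BoolP
open import Data.Fin using (Fin; zero; suc; inject₁)
import Data.Fin.Properties as FinP
open import Data.Product using (Σ; _×_; _,_; proj₁; proj₂; ∃; ∃-syntax)
open import Data.Product.Properties using (≡-dec)
open import Data.Sum using (_⊎_)
open import Data.List using (List; []; _∷_; length)
open import Data.Vec using (Vec; lookup; tabulate; map)
open import Relation.Binary.PropositionalEquality using (_≡_; _≢_)
open import Relation.Nullary using (Dec; yes; no; ¬_)
open import Relation.Nullary.Decidable using (⌊_⌋)

-- Letters of [-n,n]∖{0}: (s , i) denotes  (i+1)  if s = false  and  -(i+1)  if s = true.
Letter : ℕ → Set
Letter n = Bool × Fin n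

sgn : ∀ {n} → Letter n → Bool
sgn = proj₁

absL : ∀ {n} → Letter n → Fin n
absL = proj₂

neg : ∀ {n} → Letter n → Letter n
neg (s , i) = (not s , i)

_≟L_ : ∀ {n} (x y : Letter n) → Dec (x ≡ y)
_≟L_ = ≡-dec BoolP._≟_ FinP._≟_

-- An element of B_n in window notation: w[i] = π(i+1).
Window : ℕ → Set
Window n = Vec (Letter n) n

-- π ∈ B_n : |π(1)|,...,|π(n)| are distinct (hence a permutation of [n]).
IsSignedPerm : ∀ {n} → Window n → Set
IsSignedPerm {n} w = ∀ (i j : Fin n) → absL (lookup w i) ≡ absL (lookup w j) → i ≡ j

app : ∀ {n} → Window n → Letter n → Letter n
app w (false , i) = lookup w i
app w (true , i) = neg (lookup w i)

win : ∀ {n} → (Letter n → Letter n) → Window n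
win f = tabulate (λ i → f (false , i))

_∘B_ : ∀ {n} → Window n → Window n → Window n
u ∘B π = map (app u) π

idB : ∀ {n} → Window n
idB = win (λ x → x)

tr : ∀ {n} → Letter n → Letter n → Letter n → Letter n
tr a b x = if ⌊ x ≟L a ⌋ then b else (if ⌊ x ≟L b ⌋ then a else x)

-- Coxeter generators: index zero ↦ s_0 = t_{1,-1};
-- index suc j ↦ s_{j+1} = t_{j+1,j+2} t_{-(j+1),-(j+2)}.
gen : ∀ {n} → Fin n → Window n
gen {suc m} zero = win (tr (false , zero) (true , zero))
gen {suc m} (suc j) =
  win (λ x → tr (false , inject₁ j) (false , suc j)
              (tr (true , inject₁ j) (true , suc j) x))

eval : ∀ {n} → List (Fin n) → Window n
eval [] = idB
eval (k ∷ ks) = gen k ∘B eval ks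

IsLength : ∀ {n} → Window n → ℕ → Set
IsLength {n} π k =
  (Σ (List (Fin n)) λ ws → length ws ≡ k × eval ws ≡ π)
  × (∀ (ws : List (Fin n)) → eval ws ≡ π → k ≤ length ws)

uFun : ∀ {n} → Letter n → Letter n → Letter n → Letter n
uFun a b x with b ≟L neg a
... | yes _ = tr a (neg a) x
... | no _  = tr a b (tr (neg a) (neg b) x)

uB : ∀ {n} → Letter n → Letter n → Window n
uB a b = win (uFun a b)

UDefined : ∀ {n} → Window n → Letter n → Letter n → Set
UDefined π a b =
  (a ≡ neg b)
  ⊎ (sgn a ≡ sgn b)
  ⊎ (∃[ x ] ∃[ y ] (app π x ≡ a × app π y ≡ b × sgn x ≡ sgn y))

InStrongDescB : ∀ {n} → Window n → Window n → Set
InStrongDescB π w =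
  ∃[ a ] ∃[ b ] (a ≢ b × UDefined π a b × w ≡ uB a b
     × ∃[ k ] (IsLength π (suc k) × IsLength (w ∘B π) k))

-- Encode π ∈ B_n by the odd permutation f of the letters -n < … < -1 < 1 < … < n.  Then 2ℓ(π) is the number of
-- inversions of f plus the number of negative entries.  For an inversion of f (values x < y at positions p > q),
-- applying u_{x,y} lowers this count by at least 2, and by exactly 2 when u_{x,y} is defined and no point of the
-- graph of f lies strictly inside the box (q, p) × (x, y); such a covering inversion thus gives u_{x,y} ∈ D(π).
-- If D(π) ⊆ D(σ), every such inversion of π is an inversion of σ, since otherwise u_{x,y} would lengthen σ.  This
-- propagates to all inversions: an inversion whose box contains a point splits into two smaller ones, and a
-- covering inversion with x < 0 < y at positions q < 0 < p is forced by the smaller inversions (x, -x) and (-y, y).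
-- So equal descent sets give π and σ the same inversions, which makes them equal.

module Submission where

open import Defs
open import Data.Nat using (ℕ; zero; suc; _+_; _*_; _∸_; _≤_; _<_; _⊔_; z≤n; s≤s; _≤?_; _<?_)
open import Data.Nat.Properties
open import Data.Nat.Tactic.RingSolver using (solve-∀)
open import Algebra.Properties.Semiring.Sum +-*-semiring using (sum; sum-cong-≗; ∑-distrib-+; *-distribˡ-sum)
open import Data.Fin as F using (Fin; zero; suc; toℕ; _↑ˡ_; _↑ʳ_)
import Data.Fin.Properties as FP
open import Data.Product using (_×_; _,_; proj₁; proj₂; ∃)
open import Data.Sum using (_⊎_; inj₁; inj₂; map₂)
open import Relation.Binary.PropositionalEquality
open import Relation.Binary using (tri<; tri≈; tri>)
open import Relation.Nullary using (Dec; yes; no; ¬_)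
open import Data.Empty using (⊥; ⊥-elim)
open import Data.Bool using (true; false)
import Data.Bool.Properties as BoolP
open import Data.Vec using (lookup)
open import Data.List using ([]; _∷_; length)
import Data.Vec.Properties as VP
open import Relation.Nullary.Decidable using (_×-dec_)
open import Function using (_∘_)

sum-mono-≤ : ∀ {k} {f g : Fin k → ℕ} → (∀ i → f i ≤ g i) → sum f ≤ sum g
sum-mono-≤ {zero} e = z≤n
sum-mono-≤ {suc k} e = +-mono-≤ (e zero) (sum-mono-≤ (λ i → e (suc i)))

sum-zero : ∀ {k} {f : Fin k → ℕ} → (∀ i → f i ≡ 0) → sum f ≡ 0
sum-zero {zero} e = refl
sum-zero {suc k} e rewrite e zero = sum-zero (λ i → e (suc i))

sum-supported : ∀ {k} (f : Fin k → ℕ) (c : Fin k) → (∀ i → i ≢ c → f i ≡ 0) → sum f ≡ f c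
sum-supported {suc k} f zero e = trans (cong (f zero +_) (sum-zero (λ i → e (suc i) (λ ())))) (+-identityʳ _)
sum-supported {suc k} f (suc c) e rewrite e zero (λ ()) =
  sum-supported (λ i → f (suc i)) c (λ i i≢c → e (suc i) (λ eq → i≢c (FP.suc-injective eq)))

𝟙 : ∀ {p} {P : Set p} → Dec P → ℕ
𝟙 (yes _) = 1
𝟙 (no _) = 0

𝟙-yes : ∀ {p} {P : Set p} (d : Dec P) → P → 𝟙 d ≡ 1
𝟙-yes (yes _) _ = refl
𝟙-yes (no ¬x) x = ⊥-elim (¬x x)

𝟙-no : ∀ {p} {P : Set p} (d : Dec P) → ¬ P → 𝟙 d ≡ 0
𝟙-no (yes x) ¬x = ⊥-elim (¬x x)
𝟙-no (no _) _ = refl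

𝟙-mono : ∀ {p q} {P : Set p} {Q : Set q} (dP : Dec P) (dQ : Dec Q) → (P → Q) → 𝟙 dP ≤ 𝟙 dQ
𝟙-mono (yes x) (yes _) h = ≤-refl
𝟙-mono (yes x) (no ¬y) h = ⊥-elim (¬y (h x))
𝟙-mono (no _) dQ h = z≤n

𝟙*𝟙-disjoint : ∀ {a b} {P : Set a} {Q : Set b} (dP : Dec P) (dQ : Dec Q) → (P → Q → ⊥) → 𝟙 dP * 𝟙 dQ ≡ 0
𝟙*𝟙-disjoint (yes x) (yes y) h = ⊥-elim (h x y)
𝟙*𝟙-disjoint (yes x) (no _) h = refl
𝟙*𝟙-disjoint (no _) dQ h = refl

sum-δ : ∀ {k} (c : Fin k) (h : Fin k → ℕ) → sum (λ j → 𝟙 (j F.≟ c) * h j) ≡ h c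
sum-δ c h = trans (sum-supported _ c (λ i i≢c → cong (_* h i) (𝟙-no (i F.≟ c) i≢c)))
                (trans (cong (_* h c) (𝟙-yes (c F.≟ c) refl)) (+-identityʳ _))

sum₂ : ∀ {k} → (Fin k → Fin k → ℕ) → ℕ
sum₂ g = sum λ i → sum λ j → g i j

sum₂-distrib-+ : ∀ {k} (f g : Fin k → Fin k → ℕ) → sum₂ (λ i j → f i j + g i j) ≡ sum₂ f + sum₂ g
sum₂-distrib-+ f g = trans (sum-cong-≗ (λ i → ∑-distrib-+ (f i) (g i))) (∑-distrib-+ (λ i → sum (f i)) (λ i → sum (g i)))

sum₂-δˡ : ∀ {k} (c : Fin k) (h : Fin k → ℕ) → sum₂ (λ i j → 𝟙 (i F.≟ c) * h j) ≡ sum h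
sum₂-δˡ c h = trans (sum-supported _ c (λ i i≢c → sum-zero (λ j → cong (_* h j) (𝟙-no (i F.≟ c) i≢c))))
                  (sum-cong-≗ (λ j → trans (cong (_* h j) (𝟙-yes (c F.≟ c) refl)) (+-identityʳ _)))

sum₂-δʳ : ∀ {k} (c : Fin k) (h : Fin k → ℕ) → sum₂ (λ i j → 𝟙 (j F.≟ c) * h i) ≡ sum h
sum₂-δʳ c h = sum-cong-≗ (λ i → sum-δ c (λ _ → h i))

sum₂-δδ : ∀ {k} (c d : Fin k) (z : ℕ) → sum₂ (λ i j → 𝟙 (i F.≟ c) * (𝟙 (j F.≟ d) * z)) ≡ z
sum₂-δδ c d z = trans (sum-cong-≗ row) (sum-δ c (λ _ → z))
  where
  row : ∀ i → sum (λ j → 𝟙 (i F.≟ c) * (𝟙 (j F.≟ d) * z)) ≡ 𝟙 (i F.≟ c) * z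
  row i = trans (sym (*-distribˡ-sum (𝟙 (i F.≟ c)) (λ j → 𝟙 (j F.≟ d) * z))) (cong (𝟙 (i F.≟ c) *_) (sum-δ d (λ _ → z)))

injective⇒surjective : ∀ {k} (g : Fin k → Fin k) → (∀ i j → g i ≡ g j → i ≡ j) → ∀ y → ∃ λ x → g x ≡ y
injective⇒surjective {zero} g inj ()
injective⇒surjective {suc k} g inj y with FP.any? (λ x → g x F.≟ y)
... | yes hit = hit
... | no miss with FP.pigeonhole (n<1+n k) (λ x → F.punchOut {i = y} {j = g x} (λ e → miss (x , sym e)))
...   | i , j , i<j , e = ⊥-elim (<-irrefl (cong toℕ i≡j) i<j)
  where
  i≡j : i ≡ j
  i≡j = inj i j (FP.punchOut-injective {i = y} (λ e → miss (i , sym e)) (λ e → miss (j , sym e)) e)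

opposite-sum : ∀ {k} (c : Fin k) → toℕ (F.opposite c) + suc (toℕ c) ≡ k
opposite-sum c = trans (cong (_+ suc (toℕ c)) (FP.opposite-prop c)) (m∸n+n≡m (FP.toℕ<n c))

opposite-reverses-< : ∀ {k} {c d : Fin k} → toℕ c < toℕ d → toℕ (F.opposite d) < toℕ (F.opposite c)
opposite-reverses-< {k} {c} {d} c<d = +-cancelʳ-< (suc (toℕ c)) _ _ (begin-strict
  toℕ (F.opposite d) + suc (toℕ c) <⟨ +-monoʳ-< (toℕ (F.opposite d)) (s≤s c<d) ⟩
  toℕ (F.opposite d) + suc (toℕ d) ≡⟨ opposite-sum d ⟩
  k                                ≡⟨ opposite-sum c ⟨
  toℕ (F.opposite c) + suc (toℕ c) ∎)
  where open ≤-Reasoning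

opposite-adjacent : ∀ {k} {c d : Fin k} → toℕ d ≡ suc (toℕ c) → toℕ (F.opposite c) ≡ suc (toℕ (F.opposite d))
opposite-adjacent {k} {c} {d} d≡1+c = +-cancelʳ-≡ (suc (toℕ c)) _ _ (begin
  toℕ (F.opposite c) + suc (toℕ c)   ≡⟨ opposite-sum c ⟩
  k                                  ≡⟨ opposite-sum d ⟨
  toℕ (F.opposite d) + suc (toℕ d)   ≡⟨ cong (λ z → toℕ (F.opposite d) + suc z) d≡1+c ⟩
  toℕ (F.opposite d) + suc (suc (toℕ c)) ≡⟨ +-suc (toℕ (F.opposite d)) (suc (toℕ c)) ⟩
  suc (toℕ (F.opposite d)) + suc (toℕ c) ∎)
  where open ≡-Reasoning

StepIncreasing : ∀ {k} → (Fin k → Fin k) → Set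
StepIncreasing g = ∀ c d → toℕ d ≡ suc (toℕ c) → toℕ (g c) < toℕ (g d)

stepIncreasing⇒≥ : ∀ {k} (g : Fin k → Fin k) → StepIncreasing g → ∀ c → toℕ c ≤ toℕ (g c)
stepIncreasing⇒≥ {k} g inc c = go (toℕ c) c refl
  where
  go : ∀ m (c : Fin k) → toℕ c ≡ m → m ≤ toℕ (g c)
  go zero c _ = z≤n
  go (suc m) c c≡1+m = ≤-trans (s≤s (go m c⁻ (FP.toℕ-fromℕ< m<k))) (inc c⁻ c (trans c≡1+m (cong suc (sym (FP.toℕ-fromℕ< m<k)))))
    where
    m<k : m < k
    m<k = <-trans (subst (m <_) (sym c≡1+m) (n<1+n m)) (FP.toℕ<n c)
    c⁻ : Fin k
    c⁻ = F.fromℕ< m<k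

stepIncreasing⇒id : ∀ {k} (g : Fin k → Fin k) → StepIncreasing g → ∀ c → g c ≡ c
stepIncreasing⇒id {k} g inc c = FP.toℕ-injective (≤-antisym g≤ (stepIncreasing⇒≥ g inc c))
  where
  ḡ : Fin k → Fin k
  ḡ c = F.opposite (g (F.opposite c))
  ḡ-inc : StepIncreasing ḡ
  ḡ-inc c d d≡1+c = opposite-reverses-< (inc (F.opposite d) (F.opposite c) (opposite-adjacent d≡1+c))
  g≤ : toℕ (g c) ≤ toℕ c
  g≤ = ≮⇒≥ (λ c<gc → <⇒≱ (opposite-reverses-< c<gc)
          (subst (λ z → toℕ (F.opposite c) ≤ toℕ (F.opposite (g z))) (FP.opposite-involutive c)
                 (stepIncreasing⇒≥ ḡ ḡ-inc (F.opposite c))))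

module Line (n : ℕ) where

  -- Codes 0, …, 2n-1 stand for the letters -n < … < -1 < 1 < … < n (see `encode`): `opp` is negation,
  -- and the codes below n are the negative letters.
  Code : Set
  Code = Fin (n + n)

  opp : Code → Code
  opp = F.opposite

  opp-involutive : ∀ c → opp (opp c) ≡ c
  opp-involutive = FP.opposite-involutive

  opp-injective : ∀ {c d} → opp c ≡ opp d → c ≡ d
  opp-injective {c} {d} e = trans (sym (opp-involutive c)) (trans (cong opp e) (opp-involutive d))

  opp-negative : ∀ c → toℕ c < n → n ≤ toℕ (opp c)
  opp-negative c c<n = +-cancelʳ-≤ n n (toℕ (opp c)) (begin
    n + n                      ≡⟨ opposite-sum c ⟨
    toℕ (opp c) + suc (toℕ c)  ≤⟨ +-monoʳ-≤ (toℕ (opp c)) c<n ⟩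
    toℕ (opp c) + n            ∎)
    where open ≤-Reasoning

  opp-positive : ∀ c → n ≤ toℕ c → toℕ (opp c) < n
  opp-positive c n≤c = +-cancelʳ-< (suc (toℕ c)) (toℕ (opp c)) n (begin-strict
    toℕ (opp c) + suc (toℕ c)  ≡⟨ opposite-sum c ⟩
    n + n                      <⟨ +-monoʳ-< n (s≤s n≤c) ⟩
    n + suc (toℕ c)            ∎)
    where open ≤-Reasoning

  opp-≢ : ∀ c → opp c ≢ c
  opp-≢ c e with toℕ c <? n
  ... | yes c<n = <⇒≱ c<n (subst (λ z → n ≤ toℕ z) e (opp-negative c c<n))
  ... | no c≮n = <⇒≱ (subst (λ z → toℕ z < n) e (opp-positive c (≮⇒≥ c≮n))) (≮⇒≥ c≮n)

  -- Abstract only to keep type checking fast: proofs use these decisions solely through 𝟙-yes and 𝟙-no.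
  abstract
    _<?ᶜ_ : (c d : Code) → Dec (toℕ c < toℕ d)
    c <?ᶜ d = toℕ c <? toℕ d

  swap : Code → Code → Code → Code
  swap a b c with c F.≟ a
  ... | yes _ = b
  ... | no _ with c F.≟ b
  ...   | yes _ = a
  ...   | no _ = c

  swap-left : ∀ a b → swap a b a ≡ b
  swap-left a b with a F.≟ a
  ... | yes _ = refl
  ... | no a≢a = ⊥-elim (a≢a refl)

  swap-right : ∀ a b → swap a b b ≡ a
  swap-right a b with b F.≟ a
  ... | yes b≡a = b≡a
  ... | no _ with b F.≟ b
  ...   | yes _ = refl
  ...   | no b≢b = ⊥-elim (b≢b refl)

  swap-other : ∀ a b c → c ≢ a → c ≢ b → swap a b c ≡ c
  swap-other a b c c≢a c≢b with c F.≟ a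
  ... | yes c≡a = ⊥-elim (c≢a c≡a)
  ... | no _ with c F.≟ b
  ...   | yes c≡b = ⊥-elim (c≢b c≡b)
  ...   | no _ = refl

  swap-comm : ∀ a b c → swap a b c ≡ swap b a c
  swap-comm a b c = go (c F.≟ a) (c F.≟ b)
    where
    go : Dec (c ≡ a) → Dec (c ≡ b) → swap a b c ≡ swap b a c
    go (yes refl) (yes refl) = refl
    go (yes refl) (no _) = trans (swap-left c b) (sym (swap-right b c))
    go (no _) (yes refl) = trans (swap-right a c) (sym (swap-left c a))
    go (no c≢a) (no c≢b) = trans (swap-other a b c c≢a c≢b) (sym (swap-other b a c c≢b c≢a))

  swap-involutive : ∀ a b c → swap a b (swap a b c) ≡ c
  swap-involutive a b c = go (c F.≟ a) (c F.≟ b)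
    where
    go : Dec (c ≡ a) → Dec (c ≡ b) → swap a b (swap a b c) ≡ c
    go (yes refl) _ = trans (cong (swap c b) (swap-left c b)) (swap-right c b)
    go (no _) (yes refl) = trans (cong (swap a c) (swap-right a c)) (swap-left a c)
    go (no c≢a) (no c≢b) = trans (cong (swap a b) (swap-other a b c c≢a c≢b)) (swap-other a b c c≢a c≢b)

  swap-injective : ∀ a b {c d} → swap a b c ≡ swap a b d → c ≡ d
  swap-injective a b {c} {d} e = trans (sym (swap-involutive a b c)) (trans (cong (swap a b) e) (swap-involutive a b d))

  swap-swap-disjoint : ∀ a b c d v → a ≢ c → a ≢ d → b ≢ c → b ≢ d → swap a b (swap c d v) ≡ swap c d (swap a b v)
  swap-swap-disjoint a b c d v a≢c a≢d b≢c b≢d = go (v F.≟ a) (v F.≟ b) (v F.≟ c) (v F.≟ d)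
    where
    go : Dec (v ≡ a) → Dec (v ≡ b) → Dec (v ≡ c) → Dec (v ≡ d) → swap a b (swap c d v) ≡ swap c d (swap a b v)
    go (yes refl) _ _ _ =
        trans (cong (swap v b) (swap-other c d v a≢c a≢d))
              (trans (swap-left v b) (sym (trans (cong (swap c d) (swap-left v b)) (swap-other c d b b≢c b≢d))))
    go (no _) (yes refl) _ _ =
        trans (cong (swap a v) (swap-other c d v b≢c b≢d))
              (trans (swap-right a v) (sym (trans (cong (swap c d) (swap-right a v)) (swap-other c d a a≢c a≢d))))
    go (no v≢a) (no v≢b) (yes refl) _ =
        trans (cong (swap a b) (swap-left v d))
              (trans (swap-other a b d (λ e → a≢d (sym e)) (λ e → b≢d (sym e)))
                     (sym (trans (cong (swap v d) (swap-other a b v v≢a v≢b)) (swap-left v d))))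
    go (no v≢a) (no v≢b) (no _) (yes refl) =
        trans (cong (swap a b) (swap-right c v))
              (trans (swap-other a b c (λ e → a≢c (sym e)) (λ e → b≢c (sym e)))
                     (sym (trans (cong (swap c v) (swap-other a b v v≢a v≢b)) (swap-right c v))))
    go (no v≢a) (no v≢b) (no v≢c) (no v≢d) =
        trans (cong (swap a b) (swap-other c d v v≢c v≢d))
              (trans (swap-other a b v v≢a v≢b) (sym (trans (cong (swap c d) (swap-other a b v v≢a v≢b)) (swap-other c d v v≢c v≢d))))

  swap-opp : ∀ a b c → swap (opp a) (opp b) (opp c) ≡ opp (swap a b c)
  swap-opp a b c = go (c F.≟ a) (c F.≟ b)
    where
    go : Dec (c ≡ a) → Dec (c ≡ b) → swap (opp a) (opp b) (opp c) ≡ opp (swap a b c)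
    go (yes refl) _ = trans (swap-left (opp c) (opp b)) (cong opp (sym (swap-left c b)))
    go (no _) (yes refl) = trans (swap-right (opp a) (opp c)) (cong opp (sym (swap-right a c)))
    go (no c≢a) (no c≢b) = trans (swap-other (opp a) (opp b) (opp c) (λ e → c≢a (opp-injective e)) (λ e → c≢b (opp-injective e)))
                                  (cong opp (sym (swap-other a b c c≢a c≢b)))

  Injective : (Code → Code) → Set
  Injective f = ∀ i j → f i ≡ f j → i ≡ j

  preimage : (f : Code → Code) → Injective f → Code → Code
  preimage f inj v = proj₁ (injective⇒surjective f inj v)

  preimage-spec : ∀ f inj v → f (preimage f inj v) ≡ v
  preimage-spec f inj v = proj₂ (injective⇒surjective f inj v)

  inversion : (Code → Code) → Code → Code → ℕ
  inversion f i j = 𝟙 (i <?ᶜ j) * 𝟙 (f j <?ᶜ f i)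

  inversions : (Code → Code) → ℕ
  inversions f = sum₂ (inversion f)

  inversions-cong : ∀ {f g} → (∀ c → f c ≡ g c) → inversions f ≡ inversions g
  inversions-cong e = sum-cong-≗ (λ i → sum-cong-≗ (λ j → cong₂ (λ u v → 𝟙 (i <?ᶜ j) * 𝟙 (u <?ᶜ v)) (e j) (e i)))

  Covering : (Code → Code) → Code → Code → Code → Code → Set
  Covering f x y p q = ∀ k → toℕ q < toℕ k → toℕ k < toℕ p → toℕ x < toℕ (f k) → toℕ (f k) < toℕ y → ⊥

  -- For q < p, inversions f − inversions f′ = 1 + (outside q p − outside p q) = 1 + 2·#{q < k < p | a < f k < b};
  -- `inversions-swap` states this with the subtractions moved across.
  module ValueSwap (f : Code → Code) (inj : Injective f) (a b p q : Code) (a<b : toℕ a < toℕ b)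
                   (fp≡a : f p ≡ a) (fq≡b : f q ≡ b) where

    f′ : Code → Code
    f′ c = swap a b (f c)

    between : Code → ℕ
    between k = 𝟙 (a <?ᶜ f k) * 𝟙 (f k <?ᶜ b)

    correction : Code → Code → Code → Code → ℕ
    correction x y i j = 𝟙 (i F.≟ x) * (𝟙 (x <?ᶜ j) * between j) + 𝟙 (j F.≟ y) * (𝟙 (i <?ᶜ y) * between i)
                       + 𝟙 (i F.≟ x) * (𝟙 (j F.≟ y) * 𝟙 (x <?ᶜ y))

    outside : Code → Code → ℕ
    outside x y = sum (λ j → 𝟙 (x <?ᶜ j) * between j) + sum (λ i → 𝟙 (i <?ᶜ y) * between i)

    sum₂-correction : ∀ x y → sum₂ (correction x y) ≡ outside x y + 𝟙 (x <?ᶜ y)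
    sum₂-correction x y = begin
      sum₂ (correction x y)                             ≡⟨ sum₂-distrib-+ (λ i j → left i j + right i j) diag ⟩
      sum₂ (λ i j → left i j + right i j) + sum₂ diag   ≡⟨ cong₂ _+_ (sum₂-distrib-+ left right) (sum₂-δδ x y _) ⟩
      sum₂ left + sum₂ right + 𝟙 (x <?ᶜ y)              ≡⟨ cong (_+ 𝟙 (x <?ᶜ y)) (cong₂ _+_ (sum₂-δˡ x _) (sum₂-δʳ y _)) ⟩
      outside x y + 𝟙 (x <?ᶜ y)                         ∎
      where
      open ≡-Reasoning
      left right diag : Code → Code → ℕ
      left i j = 𝟙 (i F.≟ x) * (𝟙 (x <?ᶜ j) * between j)
      right i j = 𝟙 (j F.≟ y) * (𝟙 (i <?ᶜ y) * between i)
      diag i j = 𝟙 (i F.≟ x) * (𝟙 (j F.≟ y) * 𝟙 (x <?ᶜ y))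

    p≢q : p ≢ q
    p≢q p≡q = <-irrefl (cong toℕ (trans (sym fp≡a) (trans (cong f p≡q) fq≡b))) a<b

    between-p : between p ≡ 0
    between-p rewrite fp≡a | 𝟙-no (a <?ᶜ a) (<-irrefl refl) = refl

    between-q : between q ≡ 0
    between-q rewrite fq≡b | 𝟙-no (b <?ᶜ b) (<-irrefl refl) = *-zeroʳ (𝟙 (a <?ᶜ b))

    ≢⇒toℕ≢ : ∀ {c d : Code} → c ≢ d → toℕ c ≢ toℕ d
    ≢⇒toℕ≢ c≢d e = c≢d (FP.toℕ-injective e)

    below-b-split : ∀ c → c ≢ a → c ≢ b → 𝟙 (c <?ᶜ b) ≡ 𝟙 (c <?ᶜ a) + 𝟙 (a <?ᶜ c) * 𝟙 (c <?ᶜ b)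
    below-b-split c c≢a c≢b with <-cmp (toℕ c) (toℕ a)
    ... | tri< c<a _ _ rewrite 𝟙-yes (c <?ᶜ b) (<-trans c<a a<b) | 𝟙-yes (c <?ᶜ a) c<a
          | 𝟙-no (a <?ᶜ c) (<-asym c<a) = refl
    ... | tri≈ _ c≡a _ = ⊥-elim (≢⇒toℕ≢ c≢a c≡a)
    ... | tri> _ _ a<c rewrite 𝟙-no (c <?ᶜ a) (<-asym a<c) | 𝟙-yes (a <?ᶜ c) a<c = sym (+-identityʳ _)

    above-a-split : ∀ c → c ≢ a → c ≢ b → 𝟙 (a <?ᶜ c) ≡ 𝟙 (b <?ᶜ c) + 𝟙 (a <?ᶜ c) * 𝟙 (c <?ᶜ b)
    above-a-split c c≢a c≢b with <-cmp (toℕ c) (toℕ b)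
    ... | tri< c<b _ _ rewrite 𝟙-yes (c <?ᶜ b) c<b | 𝟙-no (b <?ᶜ c) (<-asym c<b) = sym (*-identityʳ _)
    ... | tri≈ _ c≡b _ = ⊥-elim (≢⇒toℕ≢ c≢b c≡b)
    ... | tri> _ _ b<c rewrite 𝟙-no (c <?ᶜ b) (<-asym b<c) | 𝟙-yes (b <?ᶜ c) b<c
          | 𝟙-yes (a <?ᶜ c) (<-trans a<b b<c) = refl

    f≢a : ∀ {j} → j ≢ p → f j ≢ a
    f≢a j≢p e = j≢p (inj _ _ (trans e (sym fp≡a)))

    f≢b : ∀ {j} → j ≢ q → f j ≢ b
    f≢b j≢q e = j≢q (inj _ _ (trans e (sym fq≡b)))

    f′-at-p : ∀ {i} → i ≡ p → f′ i ≡ b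
    f′-at-p refl = trans (cong (swap a b) fp≡a) (swap-left a b)

    f′-at-q : ∀ {i} → i ≡ q → f′ i ≡ a
    f′-at-q refl = trans (cong (swap a b) fq≡b) (swap-right a b)

    f′-elsewhere : ∀ {i} → i ≢ p → i ≢ q → f′ i ≡ f i
    f′-elsewhere i≢p i≢q = swap-other a b _ (f≢a i≢p) (f≢b i≢q)

    𝟙<-irrefl : ∀ {i j} → i ≡ j → 𝟙 (i <?ᶜ j) ≡ 0
    𝟙<-irrefl refl = 𝟙-no (_ <?ᶜ _) (<-irrefl refl)

    𝟙<-cong : ∀ {c c′ d d′} → c ≡ c′ → d ≡ d′ → 𝟙 (c <?ᶜ d) ≡ 𝟙 (c′ <?ᶜ d′)
    𝟙<-cong refl refl = refl

    𝟙a<b : 𝟙 (a <?ᶜ b) ≡ 1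
    𝟙a<b = 𝟙-yes (a <?ᶜ b) a<b

    𝟙b<a : 𝟙 (b <?ᶜ a) ≡ 0
    𝟙b<a = 𝟙-no (b <?ᶜ a) (<-asym a<b)

    -- The nine cases of `pointwise`, once the brackets comparing i and j with p and q are evaluated.
    private
      pp : ∀ X T U L B L′ B′ → X ≡ 0 → L ≡ 0 → L′ ≡ 0 →
           X * T + ((0 + 1 * (L * B)) + 0) ≡ X * U + ((1 * (L′ * B′) + 0) + 1 * (0 * 0))
      pp X T U L B L′ B′ refl refl refl = refl
      pq : ∀ X T U Lpj Bj Liq Bi Lpq → T ≡ 1 → U ≡ 0 → Bj ≡ 0 → Bi ≡ 0 → Lpq ≡ X →
           X * T + ((0 + 0) + 0) ≡ X * U + ((1 * (Lpj * Bj) + 1 * (Liq * Bi)) + 1 * (1 * Lpq))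
      pq X T U Lpj Bj Liq Bi Lpq refl refl refl refl refl = solve-∀′ X Lpj Liq
        where solve-∀′ : ∀ X Lpj Liq → X * 1 + ((0 + 0) + 0) ≡ X * 0 + ((1 * (Lpj * 0) + 1 * (Liq * 0)) + 1 * (1 * X))
              solve-∀′ = solve-∀
      p∗ : ∀ X T U Lpj Bj Z → T ≡ U + Bj → Lpj ≡ X →
           X * T + ((0 + 0) + 0) ≡ X * U + ((1 * (Lpj * Bj) + 0) + 1 * (0 * Z))
      p∗ X T U Lpj Bj Z refl refl = solve-∀′ X U Bj Z
        where solve-∀′ : ∀ X U Bj Z → X * (U + Bj) + ((0 + 0) + 0) ≡ X * U + ((1 * (X * Bj) + 0) + 1 * (0 * Z))
              solve-∀′ = solve-∀
      qp : ∀ X T U Lqj Bj Lip Bi Lqp → T ≡ 0 → U ≡ 1 → Bj ≡ 0 → Bi ≡ 0 → Lqp ≡ X →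
           X * T + ((1 * (Lqj * Bj) + 1 * (Lip * Bi)) + 1 * (1 * Lqp)) ≡ X * U + ((0 + 0) + 0)
      qp X T U Lqj Bj Lip Bi Lqp refl refl refl refl refl = solve-∀′ X Lqj Lip
        where solve-∀′ : ∀ X Lqj Lip → X * 0 + ((1 * (Lqj * 0) + 1 * (Lip * 0)) + 1 * (1 * X)) ≡ X * 1 + ((0 + 0) + 0)
              solve-∀′ = solve-∀
      qq : ∀ X T U Lqj Bj Z Liq Bi → X ≡ 0 → Lqj ≡ 0 → Liq ≡ 0 →
           X * T + ((1 * (Lqj * Bj) + 0) + 1 * (0 * Z)) ≡ X * U + ((0 + 1 * (Liq * Bi)) + 0)
      qq X T U Lqj Bj Z Liq Bi refl refl refl = refl
      q∗ : ∀ X T U Lqj Bj Z → U ≡ T + Bj → Lqj ≡ X →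
           X * T + ((1 * (Lqj * Bj) + 0) + 1 * (0 * Z)) ≡ X * U + ((0 + 0) + 0)
      q∗ X T U Lqj Bj Z refl refl = solve-∀′ X T Bj Z
        where solve-∀′ : ∀ X T Bj Z → X * T + ((1 * (X * Bj) + 0) + 1 * (0 * Z)) ≡ X * (T + Bj) + ((0 + 0) + 0)
              solve-∀′ = solve-∀
      ∗p : ∀ X T U Lip Bi → U ≡ T + Bi → Lip ≡ X →
           X * T + ((0 + 1 * (Lip * Bi)) + 0) ≡ X * U + ((0 + 0) + 0)
      ∗p X T U Lip Bi refl refl = solve-∀′ X T Bi
        where solve-∀′ : ∀ X T Bi → X * T + ((0 + 1 * (X * Bi)) + 0) ≡ X * (T + Bi) + ((0 + 0) + 0)
              solve-∀′ = solve-∀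
      ∗q : ∀ X T U Liq Bi → T ≡ U + Bi → Liq ≡ X →
           X * T + ((0 + 0) + 0) ≡ X * U + ((0 + 1 * (Liq * Bi)) + 0)
      ∗q X T U Liq Bi refl refl = solve-∀′ X U Bi
        where solve-∀′ : ∀ X U Bi → X * (U + Bi) + ((0 + 0) + 0) ≡ X * U + ((0 + 1 * (X * Bi)) + 0)
              solve-∀′ = solve-∀

    pointwise : ∀ i j → inversion f′ i j + correction q p i j ≡ inversion f i j + correction p q i j
    pointwise i j with i F.≟ p | i F.≟ q | j F.≟ p | j F.≟ q
    ... | yes i≡p | yes i≡q | _ | _ = ⊥-elim (p≢q (trans (sym i≡p) i≡q))
    ... | _ | _ | yes j≡p | yes j≡q = ⊥-elim (p≢q (trans (sym j≡p) j≡q))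
    ... | yes i≡p | no _ | yes j≡p | no _ =
          pp (𝟙 (i <?ᶜ j)) _ _ _ (between i) _ (between j) (𝟙<-irrefl (trans i≡p (sym j≡p))) (𝟙<-irrefl i≡p) (𝟙<-irrefl (sym j≡p))
    ... | yes i≡p | no _ | no _ | yes j≡q =
          pq (𝟙 (i <?ᶜ j)) _ _ (𝟙 (p <?ᶜ j)) (between j) (𝟙 (i <?ᶜ q)) (between i) _
             (trans (𝟙<-cong (f′-at-q j≡q) (f′-at-p i≡p)) 𝟙a<b)
             (trans (𝟙<-cong (cong f j≡q) (cong f i≡p)) (trans (𝟙<-cong fq≡b fp≡a) 𝟙b<a))
             (trans (cong between j≡q) between-q) (trans (cong between i≡p) between-p) (𝟙<-cong (sym i≡p) (sym j≡q))
    ... | yes i≡p | no _ | no j≢p | no j≢q =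
          p∗ (𝟙 (i <?ᶜ j)) _ _ (𝟙 (p <?ᶜ j)) (between j) (𝟙 (p <?ᶜ q))
             (trans (𝟙<-cong (f′-elsewhere j≢p j≢q) (f′-at-p i≡p))
               (trans (below-b-split (f j) (f≢a j≢p) (f≢b j≢q)) (cong (_+ between j) (𝟙<-cong refl (sym (trans (cong f i≡p) fp≡a))))))
             (𝟙<-cong (sym i≡p) refl)
    ... | no _ | yes i≡q | yes j≡p | no _ =
          qp (𝟙 (i <?ᶜ j)) _ _ (𝟙 (q <?ᶜ j)) (between j) (𝟙 (i <?ᶜ p)) (between i) _
             (trans (𝟙<-cong (f′-at-p j≡p) (f′-at-q i≡q)) 𝟙b<a)
             (trans (𝟙<-cong (cong f j≡p) (cong f i≡q)) (trans (𝟙<-cong fp≡a fq≡b) 𝟙a<b))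
             (trans (cong between j≡p) between-p) (trans (cong between i≡q) between-q) (𝟙<-cong (sym i≡q) (sym j≡p))
    ... | no _ | yes i≡q | no _ | yes j≡q =
          qq (𝟙 (i <?ᶜ j)) _ _ _ (between j) (𝟙 (q <?ᶜ p)) _ (between i) (𝟙<-irrefl (trans i≡q (sym j≡q))) (𝟙<-irrefl (sym j≡q)) (𝟙<-irrefl i≡q)
    ... | no _ | yes i≡q | no j≢p | no j≢q =
          q∗ (𝟙 (i <?ᶜ j)) _ _ (𝟙 (q <?ᶜ j)) (between j) (𝟙 (q <?ᶜ p))
             (trans (𝟙<-cong refl (trans (cong f i≡q) fq≡b))
               (trans (below-b-split (f j) (f≢a j≢p) (f≢b j≢q)) (cong (_+ between j) (sym (𝟙<-cong (f′-elsewhere j≢p j≢q) (f′-at-q i≡q))))))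
             (𝟙<-cong (sym i≡q) refl)
    ... | no i≢p | no i≢q | yes j≡p | no _ =
          ∗p (𝟙 (i <?ᶜ j)) _ _ (𝟙 (i <?ᶜ p)) (between i)
             (trans (𝟙<-cong (trans (cong f j≡p) fp≡a) refl)
               (trans (above-a-split (f i) (f≢a i≢p) (f≢b i≢q)) (cong (_+ between i) (sym (𝟙<-cong (f′-at-p j≡p) (f′-elsewhere i≢p i≢q))))))
             (𝟙<-cong refl (sym j≡p))
    ... | no i≢p | no i≢q | no _ | yes j≡q =
          ∗q (𝟙 (i <?ᶜ j)) _ _ (𝟙 (i <?ᶜ q)) (between i)
             (trans (𝟙<-cong (f′-at-q j≡q) (f′-elsewhere i≢p i≢q))
               (trans (above-a-split (f i) (f≢a i≢p) (f≢b i≢q)) (cong (_+ between i) (𝟙<-cong (sym (trans (cong f j≡q) fq≡b)) refl))))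
             (𝟙<-cong refl (sym j≡q))
    ... | no i≢p | no i≢q | no j≢p | no j≢q =
          cong (λ u → 𝟙 (i <?ᶜ j) * u + ((0 + 0) + 0)) (𝟙<-cong (f′-elsewhere j≢p j≢q) (f′-elsewhere i≢p i≢q))

    inversions-swap : inversions f′ + (outside q p + 𝟙 (q <?ᶜ p)) ≡ inversions f + (outside p q + 𝟙 (p <?ᶜ q))
    inversions-swap = begin
      inversions f′ + (outside q p + 𝟙 (q <?ᶜ p))            ≡⟨ cong (inversions f′ +_) (sum₂-correction q p) ⟨
      inversions f′ + sum₂ (correction q p)                   ≡⟨ sum₂-distrib-+ (inversion f′) (correction q p) ⟨
      sum₂ (λ i j → inversion f′ i j + correction q p i j)     ≡⟨ sum-cong-≗ (λ i → sum-cong-≗ (pointwise i)) ⟩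
      sum₂ (λ i j → inversion f i j + correction p q i j)      ≡⟨ sum₂-distrib-+ (inversion f) (correction p q) ⟩
      inversions f + sum₂ (correction p q)                    ≡⟨ cong (inversions f +_) (sum₂-correction p q) ⟩
      inversions f + (outside p q + 𝟙 (p <?ᶜ q))             ∎
      where open ≡-Reasoning

    outside-mono : toℕ q < toℕ p → outside p q ≤ outside q p
    outside-mono q<p = subst₂ _≤_ (∑-distrib-+ (λ j → 𝟙 (p <?ᶜ j) * between j) (λ i → 𝟙 (i <?ᶜ q) * between i))
                                  (∑-distrib-+ (λ j → 𝟙 (q <?ᶜ j) * between j) (λ i → 𝟙 (i <?ᶜ p) * between i))
      (sum-mono-≤ (λ k → +-mono-≤ (*-monoˡ-≤ (between k) (𝟙-mono (p <?ᶜ k) (q <?ᶜ k) (<-trans q<p)))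
                                (*-monoˡ-≤ (between k) (𝟙-mono (k <?ᶜ q) (k <?ᶜ p) (λ k<q → <-trans k<q q<p)))))

    inversions-drop : toℕ q < toℕ p → inversions f′ + 1 ≤ inversions f
    inversions-drop q<p = +-cancelʳ-≤ (outside q p) (inversions f′ + 1) (inversions f) (begin
      inversions f′ + 1 + outside q p            ≡⟨ solve-∀′ (inversions f′) (outside q p) ⟩
      inversions f′ + (outside q p + 1)          ≡⟨ cong (λ z → inversions f′ + (outside q p + z)) (𝟙-yes (q <?ᶜ p) q<p) ⟨
      inversions f′ + (outside q p + 𝟙 (q <?ᶜ p)) ≡⟨ inversions-swap ⟩
      inversions f + (outside p q + 𝟙 (p <?ᶜ q))  ≡⟨ cong (λ z → inversions f + (outside p q + z)) (𝟙-no (p <?ᶜ q) (<-asym q<p)) ⟩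
      inversions f + (outside p q + 0)            ≤⟨ +-monoʳ-≤ (inversions f) (+-monoˡ-≤ 0 (outside-mono q<p)) ⟩
      inversions f + (outside q p + 0)            ≡⟨ cong (inversions f +_) (+-identityʳ _) ⟩
      inversions f + outside q p                  ∎)
      where
      open ≤-Reasoning
      solve-∀′ : ∀ x s → x + 1 + s ≡ x + (s + 1)
      solve-∀′ = solve-∀

    outside-exact : toℕ q < toℕ p → Covering f a b p q → outside p q ≡ outside q p
    outside-exact q<p cov = trans (sym (∑-distrib-+ (λ j → 𝟙 (p <?ᶜ j) * between j) (λ i → 𝟙 (i <?ᶜ q) * between i)))
                                  (trans (sum-cong-≗ termwise) (∑-distrib-+ (λ j → 𝟙 (q <?ᶜ j) * between j) (λ i → 𝟙 (i <?ᶜ p) * between i)))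
      where
      termwise : ∀ k → 𝟙 (p <?ᶜ k) * between k + 𝟙 (k <?ᶜ q) * between k ≡ 𝟙 (q <?ᶜ k) * between k + 𝟙 (k <?ᶜ p) * between k
      termwise k with <-cmp (toℕ k) (toℕ q) | <-cmp (toℕ k) (toℕ p)
      ... | tri< k<q _ _ | _ rewrite 𝟙-no (p <?ᶜ k) (<-asym (<-trans k<q q<p)) | 𝟙-yes (k <?ᶜ q) k<q
            | 𝟙-no (q <?ᶜ k) (<-asym k<q) | 𝟙-yes (k <?ᶜ p) (<-trans k<q q<p) = refl
      ... | tri≈ _ k≡q _ | _ rewrite FP.toℕ-injective k≡q | between-q | *-zeroʳ (𝟙 (p <?ᶜ q))
            | *-zeroʳ (𝟙 (q <?ᶜ q)) | *-zeroʳ (𝟙 (q <?ᶜ p)) = refl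
      ... | tri> _ _ q<k | tri< k<p _ _ rewrite 𝟙*𝟙-disjoint (a <?ᶜ f k) (f k <?ᶜ b) (cov k q<k k<p)
            | *-zeroʳ (𝟙 (p <?ᶜ k)) | *-zeroʳ (𝟙 (k <?ᶜ q)) | *-zeroʳ (𝟙 (q <?ᶜ k)) | *-zeroʳ (𝟙 (k <?ᶜ p)) = refl
      ... | tri> _ _ q<k | tri≈ _ k≡p _ rewrite FP.toℕ-injective k≡p | between-p | *-zeroʳ (𝟙 (p <?ᶜ p))
            | *-zeroʳ (𝟙 (p <?ᶜ q)) | *-zeroʳ (𝟙 (q <?ᶜ p)) = refl
      ... | tri> _ _ q<k | tri> _ _ p<k rewrite 𝟙-yes (p <?ᶜ k) p<k | 𝟙-no (k <?ᶜ q) (<-asym q<k)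
            | 𝟙-yes (q <?ᶜ k) q<k | 𝟙-no (k <?ᶜ p) (<-asym p<k) = refl

    inversions-drop-exact : toℕ q < toℕ p → Covering f a b p q → inversions f′ + 1 ≡ inversions f
    inversions-drop-exact q<p cov = +-cancelʳ-≡ (outside q p) (inversions f′ + 1) (inversions f) (begin
      inversions f′ + 1 + outside q p            ≡⟨ solve-∀′ (inversions f′) (outside q p) ⟩
      inversions f′ + (outside q p + 1)          ≡⟨ cong (λ z → inversions f′ + (outside q p + z)) (𝟙-yes (q <?ᶜ p) q<p) ⟨
      inversions f′ + (outside q p + 𝟙 (q <?ᶜ p)) ≡⟨ inversions-swap ⟩
      inversions f + (outside p q + 𝟙 (p <?ᶜ q))  ≡⟨ cong₂ (λ u z → inversions f + (u + z)) (outside-exact q<p cov) (𝟙-no (p <?ᶜ q) (<-asym q<p)) ⟩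
      inversions f + (outside q p + 0)            ≡⟨ cong (inversions f +_) (+-identityʳ _) ⟩
      inversions f + outside q p                  ∎)
      where
      open ≡-Reasoning
      solve-∀′ : ∀ x s → x + 1 + s ≡ x + (s + 1)
      solve-∀′ = solve-∀

  abstract
    positive? : (c : Code) → Dec (n ≤ toℕ c)
    positive? c = n ≤? toℕ c

    negative? : (c : Code) → Dec (toℕ c < n)
    negative? c = toℕ c <? n

  negatives : (Code → Code) → ℕ
  negatives f = sum λ k → 𝟙 (positive? k) * 𝟙 (negative? (f k))

  -- Twice the Coxeter length of the signed permutation with code map f (see `IsLength⇒twiceLength`).
  twiceLength : (Code → Code) → ℕ
  twiceLength f = inversions f + negatives f

  negatives-cong : ∀ {f g} → (∀ c → f c ≡ g c) → negatives f ≡ negatives g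
  negatives-cong e = sum-cong-≗ (λ k → cong (λ u → 𝟙 (positive? k) * 𝟙 (negative? u)) (e k))

  twiceLength-cong : ∀ {f g} → (∀ c → f c ≡ g c) → twiceLength f ≡ twiceLength g
  twiceLength-cong e = cong₂ _+_ (inversions-cong e) (negatives-cong e)

  twiceLength-id : twiceLength (λ c → c) ≡ 0
  twiceLength-id = cong₂ _+_ (sum-zero (λ i → sum-zero (λ j → 𝟙*𝟙-disjoint (i <?ᶜ j) (j <?ᶜ i) <-asym)))
                             (sum-zero (λ k → 𝟙*𝟙-disjoint (positive? k) (negative? k) (λ n≤k k<n → <⇒≱ k<n n≤k)))

  Odd : (Code → Code) → Set
  Odd f = ∀ c → f (opp c) ≡ opp (f c)

  signedSwap : Code → Code → Code → Code
  signedSwap x y c with y F.≟ opp x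
  ... | yes _ = swap x y c
  ... | no _ = swap x y (swap (opp x) (opp y) c)

  signedSwap-reflection : ∀ x y → y ≡ opp x → ∀ c → signedSwap x y c ≡ swap x y c
  signedSwap-reflection x y y≡x̄ c with y F.≟ opp x
  ... | yes _ = refl
  ... | no y≢x̄ = ⊥-elim (y≢x̄ y≡x̄)

  signedSwap-double : ∀ x y → y ≢ opp x → ∀ c → signedSwap x y c ≡ swap x y (swap (opp y) (opp x) c)
  signedSwap-double x y y≢x̄ c with y F.≟ opp x
  ... | yes y≡x̄ = ⊥-elim (y≢x̄ y≡x̄)
  ... | no _ = cong (swap x y) (swap-comm (opp x) (opp y) c)

  ≢opp-sym : ∀ {x y} → y ≢ opp x → x ≢ opp y
  ≢opp-sym {x} {y} y≢x̄ x≡ȳ = y≢x̄ (sym (trans (cong opp x≡ȳ) (opp-involutive y)))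

  ≢opp-self : ∀ x → x ≢ opp x
  ≢opp-self x e = opp-≢ x (sym e)

  signedSwap-left : ∀ x y → signedSwap x y x ≡ y
  signedSwap-left x y with y F.≟ opp x
  ... | yes y≡x̄ = swap-left x y
  ... | no y≢x̄ = trans (cong (swap x y) (swap-other (opp x) (opp y) x (≢opp-self x) (≢opp-sym y≢x̄))) (swap-left x y)

  signedSwap-right : ∀ x y → signedSwap x y y ≡ x
  signedSwap-right x y with y F.≟ opp x
  ... | yes y≡x̄ = swap-right x y
  ... | no y≢x̄ = trans (cong (swap x y) (swap-other (opp x) (opp y) y y≢x̄ (≢opp-self y))) (swap-right x y)

  signedSwap-involutive : ∀ x y c → signedSwap x y (signedSwap x y c) ≡ c
  signedSwap-involutive x y c = go (y F.≟ opp x)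
    where
    go : Dec (y ≡ opp x) → signedSwap x y (signedSwap x y c) ≡ c
    go (yes y≡x̄) = begin
      signedSwap x y (signedSwap x y c) ≡⟨ signedSwap-reflection x y y≡x̄ _ ⟩
      swap x y (signedSwap x y c)       ≡⟨ cong (swap x y) (signedSwap-reflection x y y≡x̄ c) ⟩
      swap x y (swap x y c)             ≡⟨ swap-involutive x y c ⟩
      c                                 ∎
      where open ≡-Reasoning
    go (no y≢x̄) = begin
      signedSwap x y (signedSwap x y c)               ≡⟨ signedSwap-double x y y≢x̄ _ ⟩
      swap x y (swap ȳ x̄ (signedSwap x y c))          ≡⟨ cong (λ z → swap x y (swap ȳ x̄ z)) (signedSwap-double x y y≢x̄ c) ⟩
      swap x y (swap ȳ x̄ (swap x y (swap ȳ x̄ c)))     ≡⟨ cong (swap x y) (swap-swap-disjoint ȳ x̄ x y (swap ȳ x̄ c)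
                                                            (λ e → ≢opp-sym y≢x̄ (sym e)) (≢opp-self y ∘ sym) (≢opp-self x ∘ sym) (y≢x̄ ∘ sym)) ⟩
      swap x y (swap x y (swap ȳ x̄ (swap ȳ x̄ c)))     ≡⟨ swap-involutive x y _ ⟩
      swap ȳ x̄ (swap ȳ x̄ c)                           ≡⟨ swap-involutive ȳ x̄ c ⟩
      c                                               ∎
      where
      open ≡-Reasoning
      x̄ ȳ : Code
      x̄ = opp x
      ȳ = opp y

  signedSwap-injective : ∀ x y {c d} → signedSwap x y c ≡ signedSwap x y d → c ≡ d
  signedSwap-injective x y {c} {d} e =
    trans (sym (signedSwap-involutive x y c)) (trans (cong (signedSwap x y) e) (signedSwap-involutive x y d))

  signedSwap-odd : ∀ x y → Odd (signedSwap x y)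
  signedSwap-odd x y c = go (y F.≟ opp x)
    where
    go : Dec (y ≡ opp x) → signedSwap x y (opp c) ≡ opp (signedSwap x y c)
    go (yes refl) = begin
      signedSwap x (opp x) (opp c)        ≡⟨ signedSwap-reflection x (opp x) refl (opp c) ⟩
      swap x (opp x) (opp c)              ≡⟨ cong (λ z → swap z (opp x) (opp c)) (opp-involutive x) ⟨
      swap (opp (opp x)) (opp x) (opp c)  ≡⟨ swap-opp (opp x) x c ⟩
      opp (swap (opp x) x c)              ≡⟨ cong opp (swap-comm (opp x) x c) ⟩
      opp (swap x (opp x) c)              ≡⟨ cong opp (signedSwap-reflection x (opp x) refl c) ⟨
      opp (signedSwap x (opp x) c)        ∎
      where open ≡-Reasoning
    go (no y≢x̄) = begin
      signedSwap x y (opp c)                        ≡⟨ signedSwap-double x y y≢x̄ (opp c) ⟩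
      swap x y (swap (opp y) (opp x) (opp c))       ≡⟨ cong (swap x y) (swap-opp y x c) ⟩
      swap x y (opp (swap y x c))                   ≡⟨ cong₂ (λ u v → swap u v (opp (swap y x c))) (opp-involutive x) (opp-involutive y) ⟨
      swap (opp x̄) (opp ȳ) (opp (swap y x c))        ≡⟨ swap-opp x̄ ȳ (swap y x c) ⟩
      opp (swap x̄ ȳ (swap y x c))                    ≡⟨ cong (λ z → opp (swap x̄ ȳ z)) (swap-comm y x c) ⟩
      opp (swap x̄ ȳ (swap x y c))                    ≡⟨ cong opp (swap-swap-disjoint x̄ ȳ x y c
                                                          (≢opp-self x ∘ sym) (y≢x̄ ∘ sym) (λ e → ≢opp-sym y≢x̄ (sym e)) (≢opp-self y ∘ sym)) ⟩
      opp (swap x y (swap x̄ ȳ c))                    ≡⟨ cong (λ z → opp (swap x y z)) (swap-comm x̄ ȳ c) ⟩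
      opp (swap x y (swap ȳ x̄ c))                    ≡⟨ cong opp (signedSwap-double x y y≢x̄ c) ⟨
      opp (signedSwap x y c)                        ∎
      where
      open ≡-Reasoning
      x̄ ȳ : Code
      x̄ = opp x
      ȳ = opp y

  signedSwap-comm : ∀ x y c → signedSwap x y c ≡ signedSwap y x c
  signedSwap-comm x y c = go (y F.≟ opp x) (x F.≟ opp y)
    where
    go : Dec (y ≡ opp x) → Dec (x ≡ opp y) → signedSwap x y c ≡ signedSwap y x c
    go (yes y≡x̄) (yes x≡ȳ) =
      trans (signedSwap-reflection x y y≡x̄ c) (trans (swap-comm x y c) (sym (signedSwap-reflection y x x≡ȳ c)))
    go (yes y≡x̄) (no x≢ȳ) = ⊥-elim (≢opp-sym x≢ȳ y≡x̄)
    go (no y≢x̄) (yes x≡ȳ) = ⊥-elim (≢opp-sym y≢x̄ x≡ȳ)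
    go (no y≢x̄) (no x≢ȳ) = begin
      signedSwap x y c                      ≡⟨ signedSwap-double x y y≢x̄ c ⟩
      swap x y (swap (opp y) (opp x) c)     ≡⟨ swap-comm x y (swap (opp y) (opp x) c) ⟩
      swap y x (swap (opp y) (opp x) c)     ≡⟨ cong (swap y x) (swap-comm (opp y) (opp x) c) ⟩
      swap y x (swap (opp x) (opp y) c)     ≡⟨ signedSwap-double y x x≢ȳ c ⟨
      signedSwap y x c                      ∎
      where open ≡-Reasoning

  SameSide : Code → Code → Set
  SameSide u v = (toℕ u < n × toℕ v < n) ⊎ (n ≤ toℕ u × n ≤ toℕ v)

  SameSide-sym : ∀ {u v} → SameSide u v → SameSide v u
  SameSide-sym (inj₁ (u<n , v<n)) = inj₁ (v<n , u<n)
  SameSide-sym (inj₂ (n≤u , n≤v)) = inj₂ (n≤v , n≤u)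

  opp-not-between : ∀ {u v w} → SameSide u v → (w ≡ u ⊎ w ≡ v) → toℕ u < toℕ (opp w) → toℕ (opp w) < toℕ v → ⊥
  opp-not-between (inj₁ (u<n , v<n)) (inj₁ refl) _ w̄<v = <⇒≱ (<-trans w̄<v v<n) (opp-negative _ u<n)
  opp-not-between (inj₁ (u<n , v<n)) (inj₂ refl) _ w̄<v = <⇒≱ (<-trans w̄<v v<n) (opp-negative _ v<n)
  opp-not-between (inj₂ (n≤u , n≤v)) (inj₁ refl) u<w̄ _ = <⇒≱ (<-trans u<w̄ (opp-positive _ n≤u)) n≤u
  opp-not-between (inj₂ (n≤u , n≤v)) (inj₂ refl) u<w̄ _ = <⇒≱ (<-trans u<w̄ (opp-positive _ n≤v)) n≤u

  SameSide-opp : ∀ {u v} → SameSide u v → SameSide (opp u) (opp v)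
  SameSide-opp (inj₁ (u<n , v<n)) = inj₂ (opp-negative _ u<n , opp-negative _ v<n)
  SameSide-opp (inj₂ (n≤u , n≤v)) = inj₁ (opp-positive _ n≤u , opp-positive _ n≤v)

  𝟙negative-sameSide : ∀ {u v} → SameSide u v → 𝟙 (negative? u) ≡ 𝟙 (negative? v)
  𝟙negative-sameSide (inj₁ (u<n , v<n)) = trans (𝟙-yes (negative? _) u<n) (sym (𝟙-yes (negative? _) v<n))
  𝟙negative-sameSide (inj₂ (n≤u , n≤v)) = trans (𝟙-no (negative? _) (≤⇒≯ n≤u)) (sym (𝟙-no (negative? _) (≤⇒≯ n≤v)))

  opp-flipˡ : ∀ {c d} → toℕ c < toℕ (opp d) → toℕ d < toℕ (opp c)
  opp-flipˡ {c} {d} c<d̄ = subst (λ z → toℕ z < toℕ (opp c)) (opp-involutive d) (opposite-reverses-< c<d̄)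

  opp-flipʳ : ∀ {c d} → toℕ (opp c) < toℕ d → toℕ (opp d) < toℕ c
  opp-flipʳ {c} {d} c̄<d = subst (λ z → toℕ (opp d) < toℕ z) (opp-involutive c) (opposite-reverses-< c̄<d)

  covering-opp : ∀ {f x y p q} → Odd f → Covering f x y p q → Covering f (opp y) (opp x) (opp q) (opp p)
  covering-opp odd cov k p̄<k k<q̄ ȳ<fk fk<x̄ =
    cov (opp k) (opp-flipˡ k<q̄) (opp-flipʳ p̄<k)
        (subst (λ z → toℕ _ < toℕ z) (sym (odd k)) (opp-flipˡ fk<x̄))
        (subst (λ z → toℕ z < toℕ _) (sym (odd k)) (opp-flipʳ ȳ<fk))

  Admissible : Code → Code → Code → Code → Set
  Admissible x y p q = y ≡ opp x ⊎ SameSide x y ⊎ SameSide p q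

  module SignedSwapDrop (f : Code → Code) (inj : Injective f) (odd : Odd f) (x y p q : Code) (x<y : toℕ x < toℕ y)
                        (fp≡x : f p ≡ x) (fq≡y : f q ≡ y) (q<p : toℕ q < toℕ p) where

    f-opp : ∀ {k v} → f k ≡ v → f (opp k) ≡ opp v
    f-opp {k} e = trans (odd k) (cong opp e)

    preimages-≢ : ∀ {k k′ v v′} → f k ≡ v → f k′ ≡ v′ → v ≢ v′ → k ≢ k′
    preimages-≢ e e′ v≢v′ refl = v≢v′ (trans (sym e) e′)

    images-≢ : ∀ {k k′ v} → f k′ ≡ v → k ≢ k′ → f k ≢ v
    images-≢ e k≢k′ fk≡v = k≢k′ (inj _ _ (trans fk≡v (sym e)))

    x≢y : x ≢ y
    x≢y x≡y = <-irrefl (cong toℕ x≡y) x<y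

    -- u_{x,-x} is a single value swap, which also removes the negative entry x at the positive position p.
    module Reflection (y≡x̄ : y ≡ opp x) where

      x<n : toℕ x < n
      x<n with toℕ x <? n
      ... | yes x<n = x<n
      ... | no x≮n = ⊥-elim (<-asym x<y (subst (λ z → toℕ z < toℕ x) (sym y≡x̄) (<-≤-trans (opp-positive x (≮⇒≥ x≮n)) (≮⇒≥ x≮n))))

      q≡p̄ : q ≡ opp p
      q≡p̄ = inj q (opp p) (trans fq≡y (trans y≡x̄ (sym (f-opp fp≡x))))

      n≤p : n ≤ toℕ p
      n≤p with toℕ p <? n
      ... | yes p<n = ⊥-elim (<-asym q<p (subst (λ z → toℕ p < toℕ z) (sym q≡p̄) (<-≤-trans p<n (opp-negative p p<n))))
      ... | no p≮n = ≮⇒≥ p≮n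

      q<n : toℕ q < n
      q<n = subst (λ z → toℕ z < n) (sym q≡p̄) (opp-positive p n≤p)

      n≤y : n ≤ toℕ y
      n≤y = subst (λ z → n ≤ toℕ z) (sym y≡x̄) (opp-negative x x<n)

      negatives-pointwise : ∀ k → 𝟙 (positive? k) * 𝟙 (negative? (swap x y (f k))) + 𝟙 (k F.≟ p) * 1
                                  ≡ 𝟙 (positive? k) * 𝟙 (negative? (f k))
      negatives-pointwise k with k F.≟ p
      ... | yes refl rewrite fp≡x | swap-left x y | 𝟙-yes (positive? k) n≤p | 𝟙-no (negative? y) (≤⇒≯ n≤y)
                           | 𝟙-yes (negative? x) x<n = refl
      ... | no k≢p with k F.≟ q
      ...   | yes refl rewrite 𝟙-no (positive? k) (<⇒≱ q<n) = refl
      ...   | no k≢q rewrite swap-other x y (f k) (images-≢ fp≡x k≢p) (images-≢ fq≡y k≢q) = +-identityʳ _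

      negatives-drop : negatives (λ k → swap x y (f k)) + 1 ≡ negatives f
      negatives-drop = begin
        negatives (λ k → swap x y (f k)) + 1
          ≡⟨ cong (negatives (λ k → swap x y (f k)) +_) (sum-δ p (λ _ → 1)) ⟨
        negatives (λ k → swap x y (f k)) + sum (λ k → 𝟙 (k F.≟ p) * 1)
          ≡⟨ ∑-distrib-+ (λ k → 𝟙 (positive? k) * 𝟙 (negative? (swap x y (f k)))) (λ k → 𝟙 (k F.≟ p) * 1) ⟨
        sum (λ k → 𝟙 (positive? k) * 𝟙 (negative? (swap x y (f k))) + 𝟙 (k F.≟ p) * 1)
          ≡⟨ sum-cong-≗ negatives-pointwise ⟩
        negatives f ∎
        where open ≡-Reasoning

      module V = ValueSwap f inj x y p q x<y fp≡x fq≡y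

      drop : twiceLength (λ c → signedSwap x y (f c)) + 2 ≤ twiceLength f
      drop = subst (λ z → z + 2 ≤ twiceLength f) (sym (twiceLength-cong (λ c → signedSwap-reflection x y y≡x̄ (f c))))
                   (combine (V.inversions-drop q<p) negatives-drop)
        where
        combine : ∀ {a′ a b′ b} → a′ + 1 ≤ a → b′ + 1 ≡ b → a′ + b′ + 2 ≤ a + b
        combine {a′} {a} {b′} h refl = subst (_≤ a + (b′ + 1)) (solve-∀′ a′ b′) (+-monoˡ-≤ (b′ + 1) h)
          where solve-∀′ : ∀ a′ b′ → a′ + 1 + (b′ + 1) ≡ a′ + b′ + 2
                solve-∀′ = solve-∀

      drop-exact : Covering f x y p q → twiceLength (λ c → signedSwap x y (f c)) + 2 ≡ twiceLength f
      drop-exact cov = trans (cong (_+ 2) (twiceLength-cong (λ c → signedSwap-reflection x y y≡x̄ (f c))))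
                             (combine (V.inversions-drop-exact q<p cov) negatives-drop)
        where
        combine : ∀ {a′ a b′ b} → a′ + 1 ≡ a → b′ + 1 ≡ b → a′ + b′ + 2 ≡ a + b
        combine {a′} {b′ = b′} refl refl = solve-∀′ a′ b′
          where solve-∀′ : ∀ a′ b′ → a′ + b′ + 2 ≡ a′ + 1 + (b′ + 1)
                solve-∀′ = solve-∀

    -- Otherwise u_{x,y} is two value swaps, each removing at least one inversion; negative entries can only
    -- disappear, and none does when u_{x,y} is defined.
    module Double (y≢x̄ : y ≢ opp x) where

      x≢ȳ : x ≢ opp y
      x≢ȳ = ≢opp-sym y≢x̄

      u : Code → Code
      u c = swap x y (swap (opp y) (opp x) c)

      u-x : u x ≡ y
      u-x = trans (cong (swap x y) (swap-other (opp y) (opp x) x x≢ȳ (≢opp-self x))) (swap-left x y)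

      u-y : u y ≡ x
      u-y = trans (cong (swap x y) (swap-other (opp y) (opp x) y (≢opp-self y) y≢x̄)) (swap-right x y)

      u-x̄ : u (opp x) ≡ opp y
      u-x̄ = trans (cong (swap x y) (swap-right (opp y) (opp x))) (swap-other x y (opp y) (x≢ȳ ∘ sym) (opp-≢ y))

      u-ȳ : u (opp y) ≡ opp x
      u-ȳ = trans (cong (swap x y) (swap-left (opp y) (opp x))) (swap-other x y (opp x) (opp-≢ x) (y≢x̄ ∘ sym))

      u-other : ∀ v → v ≢ x → v ≢ y → v ≢ opp x → v ≢ opp y → u v ≡ v
      u-other v v≢x v≢y v≢x̄ v≢ȳ = trans (cong (swap x y) (swap-other (opp y) (opp x) v v≢ȳ v≢x̄)) (swap-other x y v v≢x v≢y)

      f₁ : Code → Code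
      f₁ c = swap (opp y) (opp x) (f c)

      f₁-injective : Injective f₁
      f₁-injective i j e = inj i j (swap-injective (opp y) (opp x) e)

      f₁p≡x : f₁ p ≡ x
      f₁p≡x = trans (cong (swap (opp y) (opp x)) fp≡x) (swap-other (opp y) (opp x) x x≢ȳ (≢opp-self x))

      f₁q≡y : f₁ q ≡ y
      f₁q≡y = trans (cong (swap (opp y) (opp x)) fq≡y) (swap-other (opp y) (opp x) y (≢opp-self y) y≢x̄)

      module First = ValueSwap f inj (opp y) (opp x) (opp q) (opp p) (opposite-reverses-< x<y) (f-opp fq≡y) (f-opp fp≡x)
      module Second = ValueSwap f₁ f₁-injective x y p q x<y f₁p≡x f₁q≡y

      𝟙negative-u : SameSide x y → ∀ v → 𝟙 (negative? (u v)) ≡ 𝟙 (negative? v)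
      𝟙negative-u ss v = go (v F.≟ x) (v F.≟ y) (v F.≟ opp x) (v F.≟ opp y)
        where
        go : Dec (v ≡ x) → Dec (v ≡ y) → Dec (v ≡ opp x) → Dec (v ≡ opp y) → 𝟙 (negative? (u v)) ≡ 𝟙 (negative? v)
        go (yes refl) _ _ _ = trans (cong (λ z → 𝟙 (negative? z)) u-x) (sym (𝟙negative-sameSide ss))
        go (no _) (yes refl) _ _ = trans (cong (λ z → 𝟙 (negative? z)) u-y) (𝟙negative-sameSide ss)
        go (no _) (no _) (yes refl) _ = trans (cong (λ z → 𝟙 (negative? z)) u-x̄) (sym (𝟙negative-sameSide (SameSide-opp ss)))
        go (no _) (no _) (no _) (yes refl) = trans (cong (λ z → 𝟙 (negative? z)) u-ȳ) (𝟙negative-sameSide (SameSide-opp ss))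
        go (no v≢x) (no v≢y) (no v≢x̄) (no v≢ȳ) = cong (λ z → 𝟙 (negative? z)) (u-other v v≢x v≢y v≢x̄ v≢ȳ)

      negatives-u-sameSide : SameSide x y → negatives (λ c → u (f c)) ≡ negatives f
      negatives-u-sameSide ss = sum-cong-≗ (λ k → cong (𝟙 (positive? k) *_) (𝟙negative-u ss (f k)))

      p≢q : p ≢ q
      p≢q = preimages-≢ fp≡x fq≡y x≢y

      p≢q̄ : p ≢ opp q
      p≢q̄ = preimages-≢ fp≡x (f-opp fq≡y) x≢ȳ

      q≢p̄ : q ≢ opp p
      q≢p̄ = preimages-≢ fq≡y (f-opp fp≡x) y≢x̄

      p̄≢q̄ : opp p ≢ opp q
      p̄≢q̄ = preimages-≢ (f-opp fp≡x) (f-opp fq≡y) (x≢y ∘ opp-injective)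

      module Straddling (x<n : toℕ x < n) (n≤y : n ≤ toℕ y) where

        private
          shift : ∀ P → P * 0 + (1 * P + 0) ≡ P * 1 + (0 + 0)
          shift = solve-∀
          shift-opp : ∀ P → P * 1 + (0 + 0) ≡ P * 0 + (0 + 1 * P)
          shift-opp = solve-∀

        negatives-pointwise : ∀ k → 𝟙 (positive? k) * 𝟙 (negative? (u (f k)))
                                      + (𝟙 (k F.≟ p) * 𝟙 (positive? p) + 𝟙 (k F.≟ opp q) * 𝟙 (positive? (opp q)))
                                    ≡ 𝟙 (positive? k) * 𝟙 (negative? (f k))
                                      + (𝟙 (k F.≟ q) * 𝟙 (positive? q) + 𝟙 (k F.≟ opp p) * 𝟙 (positive? (opp p)))
        negatives-pointwise k with k F.≟ p
        ... | yes refl rewrite 𝟙-no (k F.≟ q) p≢q | 𝟙-no (k F.≟ opp q) p≢q̄ | 𝟙-no (k F.≟ opp k) (≢opp-self k)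
                | fp≡x | u-x | 𝟙-no (negative? y) (≤⇒≯ n≤y) | 𝟙-yes (negative? x) x<n = shift (𝟙 (positive? k))
        ... | no k≢p with k F.≟ q
        ...   | yes refl rewrite 𝟙-no (k F.≟ opp k) (≢opp-self k) | 𝟙-no (k F.≟ opp p) q≢p̄
                | fq≡y | u-y | 𝟙-no (negative? y) (≤⇒≯ n≤y) | 𝟙-yes (negative? x) x<n = sym (shift (𝟙 (positive? k)))
        ...   | no k≢q with k F.≟ opp p
        ...     | yes refl rewrite 𝟙-no (opp p F.≟ opp q) p̄≢q̄ | f-opp fp≡x | u-x̄
                  | 𝟙-yes (negative? (opp y)) (opp-positive y n≤y) | 𝟙-no (negative? (opp x)) (≤⇒≯ (opp-negative x x<n))
                  = shift-opp (𝟙 (positive? (opp p)))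
        ...     | no k≢p̄ with k F.≟ opp q
        ...       | yes refl rewrite f-opp fq≡y | u-ȳ
                    | 𝟙-yes (negative? (opp y)) (opp-positive y n≤y) | 𝟙-no (negative? (opp x)) (≤⇒≯ (opp-negative x x<n))
                    = sym (shift-opp (𝟙 (positive? (opp q))))
        ...       | no k≢q̄ rewrite u-other (f k) (images-≢ fp≡x k≢p) (images-≢ fq≡y k≢q)
                                    (images-≢ (f-opp fp≡x) k≢p̄) (images-≢ (f-opp fq≡y) k≢q̄) = refl

        negatives-balance : negatives (λ c → u (f c)) + (𝟙 (positive? p) + 𝟙 (positive? (opp q)))
                            ≡ negatives f + (𝟙 (positive? q) + 𝟙 (positive? (opp p)))
        negatives-balance = begin
          negatives (λ c → u (f c)) + (𝟙 (positive? p) + 𝟙 (positive? (opp q)))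
            ≡⟨ cong (negatives (λ c → u (f c)) +_) (cong₂ _+_ (sum-δ p (λ _ → 𝟙 (positive? p))) (sum-δ (opp q) (λ _ → 𝟙 (positive? (opp q))))) ⟨
          negatives (λ c → u (f c)) + (sum (at p) + sum (at (opp q)))
            ≡⟨ cong (negatives (λ c → u (f c)) +_) (∑-distrib-+ (at p) (at (opp q))) ⟨
          negatives (λ c → u (f c)) + sum (λ k → at p k + at (opp q) k)
            ≡⟨ ∑-distrib-+ (λ k → 𝟙 (positive? k) * 𝟙 (negative? (u (f k)))) (λ k → at p k + at (opp q) k) ⟨
          sum (λ k → 𝟙 (positive? k) * 𝟙 (negative? (u (f k))) + (at p k + at (opp q) k))
            ≡⟨ sum-cong-≗ negatives-pointwise ⟩
          sum (λ k → 𝟙 (positive? k) * 𝟙 (negative? (f k)) + (at q k + at (opp p) k))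
            ≡⟨ ∑-distrib-+ (λ k → 𝟙 (positive? k) * 𝟙 (negative? (f k))) (λ k → at q k + at (opp p) k) ⟩
          negatives f + sum (λ k → at q k + at (opp p) k)
            ≡⟨ cong (negatives f +_) (∑-distrib-+ (at q) (at (opp p))) ⟩
          negatives f + (sum (at q) + sum (at (opp p)))
            ≡⟨ cong (negatives f +_) (cong₂ _+_ (sum-δ q (λ _ → 𝟙 (positive? q))) (sum-δ (opp p) (λ _ → 𝟙 (positive? (opp p))))) ⟩
          negatives f + (𝟙 (positive? q) + 𝟙 (positive? (opp p))) ∎
          where
          open ≡-Reasoning
          at : Code → Code → ℕ
          at c k = 𝟙 (k F.≟ c) * 𝟙 (positive? c)

        negatives-u : negatives (λ c → u (f c)) ≤ negatives f × (SameSide p q → negatives (λ c → u (f c)) ≡ negatives f)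
        negatives-u with toℕ p <? n | toℕ q <? n
        ... | yes p<n | yes q<n = ≤-reflexive balanced , (λ _ → balanced)
          where
          balanced : negatives (λ c → u (f c)) ≡ negatives f
          balanced = +-cancelʳ-≡ 1 _ _ (subst₂ (λ a b → negatives (λ c → u (f c)) + a ≡ negatives f + b)
                       (cong₂ _+_ (𝟙-no (positive? p) (<⇒≱ p<n)) (𝟙-yes (positive? (opp q)) (opp-negative q q<n)))
                       (cong₂ _+_ (𝟙-no (positive? q) (<⇒≱ q<n)) (𝟙-yes (positive? (opp p)) (opp-negative p p<n))) negatives-balance)
        ... | yes p<n | no q≮n = ⊥-elim (<-asym q<p (<-≤-trans p<n (≮⇒≥ q≮n)))
        ... | no p≮n | yes q<n = ≤-trans (m≤m+n _ 2) (≤-trans (≤-reflexive drop2) (≤-reflexive (+-identityʳ _))) , not-sameSide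
          where
          drop2 : negatives (λ c → u (f c)) + 2 ≡ negatives f + 0
          drop2 = subst₂ (λ a b → negatives (λ c → u (f c)) + a ≡ negatives f + b)
                    (cong₂ _+_ (𝟙-yes (positive? p) (≮⇒≥ p≮n)) (𝟙-yes (positive? (opp q)) (opp-negative q q<n)))
                    (cong₂ _+_ (𝟙-no (positive? q) (<⇒≱ q<n)) (𝟙-no (positive? (opp p)) (<⇒≱ (opp-positive p (≮⇒≥ p≮n))))) negatives-balance
          not-sameSide : SameSide p q → negatives (λ c → u (f c)) ≡ negatives f
          not-sameSide (inj₁ (p<n , _)) = ⊥-elim (p≮n p<n)
          not-sameSide (inj₂ (_ , n≤q)) = ⊥-elim (<⇒≱ q<n n≤q)
        ... | no p≮n | no q≮n = ≤-reflexive balanced , (λ _ → balanced)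
          where
          balanced : negatives (λ c → u (f c)) ≡ negatives f
          balanced = +-cancelʳ-≡ 1 _ _ (subst₂ (λ a b → negatives (λ c → u (f c)) + a ≡ negatives f + b)
                       (cong₂ _+_ (𝟙-yes (positive? p) (≮⇒≥ p≮n)) (𝟙-no (positive? (opp q)) (<⇒≱ (opp-positive q (≮⇒≥ q≮n)))))
                       (cong₂ _+_ (𝟙-yes (positive? q) (≮⇒≥ q≮n)) (𝟙-no (positive? (opp p)) (<⇒≱ (opp-positive p (≮⇒≥ p≮n))))) negatives-balance)

      negatives-u-≤ : negatives (λ c → u (f c)) ≤ negatives f
      negatives-u-≤ with toℕ x <? n | toℕ y <? n
      ... | yes x<n | yes y<n = ≤-reflexive (negatives-u-sameSide (inj₁ (x<n , y<n)))
      ... | yes x<n | no y≮n = proj₁ (Straddling.negatives-u x<n (≮⇒≥ y≮n))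
      ... | no x≮n | yes y<n = ⊥-elim (x≮n (<-trans x<y y<n))
      ... | no x≮n | no y≮n = ≤-reflexive (negatives-u-sameSide (inj₂ (≮⇒≥ x≮n , ≮⇒≥ y≮n)))

      negatives-u-≡ : SameSide x y ⊎ SameSide p q → negatives (λ c → u (f c)) ≡ negatives f
      negatives-u-≡ (inj₁ ss) = negatives-u-sameSide ss
      negatives-u-≡ (inj₂ sp) with toℕ x <? n | toℕ y <? n
      ... | yes x<n | yes y<n = negatives-u-sameSide (inj₁ (x<n , y<n))
      ... | yes x<n | no y≮n = proj₂ (Straddling.negatives-u x<n (≮⇒≥ y≮n)) sp
      ... | no x≮n | yes y<n = ⊥-elim (x≮n (<-trans x<y y<n))
      ... | no x≮n | no y≮n = negatives-u-sameSide (inj₂ (≮⇒≥ x≮n , ≮⇒≥ y≮n))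

      -- Only ±x, ±y can enter the box after the first swap; admissibility keeps them out.
      covering-f₁ : Covering f x y p q → SameSide x y ⊎ SameSide p q → Covering f₁ x y p q
      covering-f₁ cov adm k q<k k<p x<f₁k f₁k<y = go (f k F.≟ opp y) (f k F.≟ opp x)
        where
        outside : SameSide x y ⊎ SameSide p q → ∀ {w w′} → (w ≡ x ⊎ w ≡ y) → (w′ ≡ q ⊎ w′ ≡ p) →
                  toℕ x < toℕ (opp w) → toℕ (opp w) < toℕ y → toℕ q < toℕ (opp w′) → toℕ (opp w′) < toℕ p → ⊥
        outside (inj₁ ss) w≡ _ x<w̄ w̄<y _ _ = opp-not-between ss w≡ x<w̄ w̄<y
        outside (inj₂ sp) _ w′≡ _ _ q<w̄′ w̄′<p = opp-not-between (SameSide-sym sp) w′≡ q<w̄′ w̄′<p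
        go : Dec (f k ≡ opp y) → Dec (f k ≡ opp x) → ⊥
        go (yes fk≡ȳ) _ with inj k (opp q) (trans fk≡ȳ (sym (f-opp fq≡y)))
        ... | refl = outside adm (inj₁ refl) (inj₁ refl) (subst (λ z → toℕ x < toℕ z) f₁k≡x̄ x<f₁k)
                             (subst (λ z → toℕ z < toℕ y) f₁k≡x̄ f₁k<y) q<k k<p
          where
          f₁k≡x̄ : f₁ k ≡ opp x
          f₁k≡x̄ = trans (cong (swap (opp y) (opp x)) fk≡ȳ) (swap-left (opp y) (opp x))
        go (no _) (yes fk≡x̄) with inj k (opp p) (trans fk≡x̄ (sym (f-opp fp≡x)))
        ... | refl = outside adm (inj₂ refl) (inj₂ refl) (subst (λ z → toℕ x < toℕ z) f₁k≡ȳ x<f₁k)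
                             (subst (λ z → toℕ z < toℕ y) f₁k≡ȳ f₁k<y) q<k k<p
          where
          f₁k≡ȳ : f₁ k ≡ opp y
          f₁k≡ȳ = trans (cong (swap (opp y) (opp x)) fk≡x̄) (swap-right (opp y) (opp x))
        go (no fk≢ȳ) (no fk≢x̄) = cov k q<k k<p (subst (λ z → toℕ x < toℕ z) (swap-other (opp y) (opp x) (f k) fk≢ȳ fk≢x̄) x<f₁k)
                                              (subst (λ z → toℕ z < toℕ y) (swap-other (opp y) (opp x) (f k) fk≢ȳ fk≢x̄) f₁k<y)

      drop : twiceLength (λ c → signedSwap x y (f c)) + 2 ≤ twiceLength f
      drop = subst (λ z → z + 2 ≤ twiceLength f) (sym (twiceLength-cong (λ c → signedSwap-double x y y≢x̄ (f c))))
                   (combine (Second.inversions-drop q<p) (First.inversions-drop (opposite-reverses-< q<p)) negatives-u-≤)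
        where
        combine : ∀ {a₂ a₁ a b₂ b} → a₂ + 1 ≤ a₁ → a₁ + 1 ≤ a → b₂ ≤ b → a₂ + b₂ + 2 ≤ a + b
        combine {a₂} {_} {a} {b₂} {b} h₁ h₂ h₃ = subst (_≤ a + b) (solve-∀′ a₂ b₂) (+-mono-≤ (≤-trans (+-monoˡ-≤ 1 h₁) h₂) h₃)
          where solve-∀′ : ∀ a₂ b₂ → a₂ + 1 + 1 + b₂ ≡ a₂ + b₂ + 2
                solve-∀′ = solve-∀

      drop-exact : Covering f x y p q → SameSide x y ⊎ SameSide p q →
                   twiceLength (λ c → signedSwap x y (f c)) + 2 ≡ twiceLength f
      drop-exact cov adm = trans (cong (_+ 2) (twiceLength-cong (λ c → signedSwap-double x y y≢x̄ (f c))))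
        (combine (Second.inversions-drop-exact q<p (covering-f₁ cov adm))
             (First.inversions-drop-exact (opposite-reverses-< q<p) (covering-opp odd cov)) (negatives-u-≡ adm))
        where
        combine : ∀ {a₂ a₁ a b₂ b} → a₂ + 1 ≡ a₁ → a₁ + 1 ≡ a → b₂ ≡ b → a₂ + b₂ + 2 ≡ a + b
        combine {a₂} {b₂ = b₂} refl refl refl = solve-∀′ a₂ b₂
          where solve-∀′ : ∀ a₂ b₂ → a₂ + b₂ + 2 ≡ a₂ + 1 + 1 + b₂
                solve-∀′ = solve-∀

    twiceLength-drop : twiceLength (λ c → signedSwap x y (f c)) + 2 ≤ twiceLength f
    twiceLength-drop = go (y F.≟ opp x)
      where
      go : Dec (y ≡ opp x) → twiceLength (λ c → signedSwap x y (f c)) + 2 ≤ twiceLength f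
      go (yes y≡x̄) = Reflection.drop y≡x̄
      go (no y≢x̄) = Double.drop y≢x̄

    twiceLength-drop-exact : Covering f x y p q → Admissible x y p q → twiceLength (λ c → signedSwap x y (f c)) + 2 ≡ twiceLength f
    twiceLength-drop-exact cov adm = go (y F.≟ opp x) adm
      where
      go : Dec (y ≡ opp x) → Admissible x y p q → twiceLength (λ c → signedSwap x y (f c)) + 2 ≡ twiceLength f
      go (yes y≡x̄) _ = Reflection.drop-exact y≡x̄ cov
      go (no y≢x̄) (inj₁ y≡x̄) = ⊥-elim (y≢x̄ y≡x̄)
      go (no y≢x̄) (inj₂ adm′) = Double.drop-exact y≢x̄ cov adm′

  module AdjacentSwap (f : Code → Code) (inj : Injective f) (odd : Odd f) (x y p q : Code)
                      (fp≡x : f p ≡ x) (fq≡y : f q ≡ y) (y≡1+x : toℕ y ≡ suc (toℕ x))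
                      (adm : y ≡ opp x ⊎ SameSide x y) where

    x<y : toℕ x < toℕ y
    x<y = ≤-reflexive (sym y≡1+x)

    covering : ∀ g p q → Covering g x y p q
    covering g p q k _ _ x<gk gk<y = <-irrefl refl (<-≤-trans gk<y (subst (_≤ toℕ (g k)) (sym y≡1+x) x<gk))

    admissible : ∀ p q → Admissible x y p q
    admissible p q = map₂ inj₁ adm

    f′ : Code → Code
    f′ c = signedSwap x y (f c)

    f′-injective : Injective f′
    f′-injective i j e = inj i j (signedSwap-injective x y e)

    f′-odd : Odd f′
    f′-odd c = trans (cong (signedSwap x y) (odd c)) (signedSwap-odd x y (f c))

    twiceLength-adjacent : (toℕ q < toℕ p × twiceLength f′ + 2 ≡ twiceLength f) ⊎ (toℕ p < toℕ q × twiceLength f + 2 ≡ twiceLength f′)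
    twiceLength-adjacent with <-cmp (toℕ p) (toℕ q)
    ... | tri< p<q _ _ = inj₂ (p<q , trans (cong (_+ 2) (sym (twiceLength-cong (λ c → signedSwap-involutive x y (f c)))))
            (SignedSwapDrop.twiceLength-drop-exact f′ f′-injective f′-odd x y q p x<y
              (trans (cong (signedSwap x y) fq≡y) (signedSwap-right x y))
              (trans (cong (signedSwap x y) fp≡x) (signedSwap-left x y)) p<q (covering f′ q p) (admissible q p)))
    ... | tri≈ _ p≡q _ = ⊥-elim (<-irrefl (cong toℕ (trans (sym fp≡x) (trans (cong f (FP.toℕ-injective p≡q)) fq≡y))) x<y)
    ... | tri> _ _ q<p = inj₁ (q<p , SignedSwapDrop.twiceLength-drop-exact f inj odd x y p q x<y fp≡x fq≡y q<p
                                       (covering f p q) (admissible p q))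

    twiceLength-adjacent-≤ : twiceLength f′ ≤ twiceLength f + 2
    twiceLength-adjacent-≤ with twiceLength-adjacent
    ... | inj₁ (_ , e) = ≤-trans (m≤m+n _ 2) (≤-trans (≤-reflexive e) (m≤m+n _ 2))
    ... | inj₂ (_ , e) = ≤-reflexive (sym e)

module Encoding (n : ℕ) where
  open Line n

  encode : Letter n → Code
  encode (false , i) = n ↑ʳ i
  encode (true , i) = F.opposite i ↑ˡ n

  decode : Code → Letter n
  decode c with F.splitAt n c
  ... | inj₁ j = (true , F.opposite j)
  ... | inj₂ j = (false , j)

  decode-encode : ∀ x → decode (encode x) ≡ x
  decode-encode (false , i) rewrite FP.splitAt-↑ʳ n n i = refl
  decode-encode (true , i) rewrite FP.splitAt-↑ˡ n (F.opposite i) n | FP.opposite-involutive i = refl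

  encode-decode : ∀ c → encode (decode c) ≡ c
  encode-decode c with F.splitAt n c in eq
  ... | inj₁ j = trans (cong (_↑ˡ n) (FP.opposite-involutive j)) (trans (cong (F.join n n) (sym eq)) (FP.join-splitAt n n c))
  ... | inj₂ j = trans (cong (F.join n n) (sym eq)) (FP.join-splitAt n n c)

  encode-injective : ∀ {x y} → encode x ≡ encode y → x ≡ y
  encode-injective {x} {y} e = trans (sym (decode-encode x)) (trans (cong decode e) (decode-encode y))

  toℕ-encode-false : ∀ i → toℕ (encode (false , i)) ≡ n + toℕ i
  toℕ-encode-false i = FP.toℕ-↑ʳ n i

  toℕ-encode-true : ∀ i → toℕ (encode (true , i)) ≡ n ∸ suc (toℕ i)
  toℕ-encode-true i = trans (FP.toℕ-↑ˡ (F.opposite i) n) (FP.opposite-prop i)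

  encode-neg-false : ∀ i → encode (true , i) ≡ opp (encode (false , i))
  encode-neg-false i = FP.toℕ-injective (begin
    toℕ (encode (true , i))              ≡⟨ toℕ-encode-true i ⟩
    n ∸ suc (toℕ i)                      ≡⟨ [m+n]∸[m+o]≡n∸o n n (suc (toℕ i)) ⟨
    (n + n) ∸ (n + suc (toℕ i))          ≡⟨ cong ((n + n) ∸_) (+-suc n (toℕ i)) ⟩
    (n + n) ∸ suc (n + toℕ i)            ≡⟨ cong (λ z → (n + n) ∸ suc z) (toℕ-encode-false i) ⟨
    (n + n) ∸ suc (toℕ (encode (false , i))) ≡⟨ FP.opposite-prop (encode (false , i)) ⟨
    toℕ (opp (encode (false , i)))       ∎)
    where open ≡-Reasoning

  encode-neg : ∀ x → encode (neg x) ≡ opp (encode x)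
  encode-neg (false , i) = encode-neg-false i
  encode-neg (true , i) = trans (sym (opp-involutive (encode (false , i)))) (cong opp (sym (encode-neg-false i)))

  decode-opp : ∀ c → decode (opp c) ≡ neg (decode c)
  decode-opp c = begin
    decode (opp c)                    ≡⟨ cong (decode ∘ opp) (encode-decode c) ⟨
    decode (opp (encode (decode c)))  ≡⟨ cong decode (encode-neg (decode c)) ⟨
    decode (encode (neg (decode c)))  ≡⟨ decode-encode _ ⟩
    neg (decode c)                    ∎
    where open ≡-Reasoning

  sgn-decode-negative : ∀ c → toℕ c < n → sgn (decode c) ≡ true
  sgn-decode-negative c c<n with decode c | encode-decode c
  ... | (true , i) | _ = refl
  ... | (false , i) | e = ⊥-elim (<⇒≱ c<n (subst (λ z → n ≤ toℕ z) e (subst (n ≤_) (sym (toℕ-encode-false i)) (m≤m+n n (toℕ i)))))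

  sgn-decode-positive : ∀ c → n ≤ toℕ c → sgn (decode c) ≡ false
  sgn-decode-positive c n≤c with decode c | encode-decode c
  ... | (false , i) | _ = refl
  ... | (true , i) | e = ⊥-elim (<⇒≱ (subst (λ z → toℕ z < n) e (subst (_< n) (sym (toℕ-encode-true i)) (∸-monoʳ-< {n} {suc (toℕ i)} {0} (s≤s z≤n) (FP.toℕ<n i)))) n≤c)

  sameSide⇒sgn≡ : ∀ {x y} → SameSide x y → sgn (decode x) ≡ sgn (decode y)
  sameSide⇒sgn≡ {x} {y} (inj₁ (x<n , y<n)) = trans (sgn-decode-negative x x<n) (sym (sgn-decode-negative y y<n))
  sameSide⇒sgn≡ {x} {y} (inj₂ (n≤x , n≤y)) = trans (sgn-decode-positive x n≤x) (sym (sgn-decode-positive y n≤y))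

  neg-involutive : ∀ (x : Letter n) → neg (neg x) ≡ x
  neg-involutive (s , i) = cong (_, i) (BoolP.not-involutive s)

  neg-≢ : ∀ (x : Letter n) → neg x ≢ x
  neg-≢ (false , i) ()
  neg-≢ (true , i) ()

  app-neg : ∀ (π : Window n) x → app π (neg x) ≡ neg (app π x)
  app-neg π (false , i) = refl
  app-neg π (true , i) = sym (neg-involutive _)

  app-∘B : ∀ (u π : Window n) x → app (u ∘B π) x ≡ app u (app π x)
  app-∘B u π (false , i) = VP.lookup-map i (app u) π
  app-∘B u π (true , i) = trans (cong neg (VP.lookup-map i (app u) π)) (sym (app-neg u (lookup π i)))

  app-injective : ∀ (π : Window n) → IsSignedPerm π → ∀ x y → app π x ≡ app π y → x ≡ y
  app-injective π perm (s , i) (t , j) e with perm i j (absL-app s t e)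
    where
    absL-app : ∀ s t → app π (s , i) ≡ app π (t , j) → absL (lookup π i) ≡ absL (lookup π j)
    absL-app false false e = cong absL e
    absL-app false true e = cong absL e
    absL-app true false e = cong absL e
    absL-app true true e = cong absL e
  ... | refl with s | t
  ...   | false | false = refl
  ...   | true | true = refl
  ...   | false | true = ⊥-elim (neg-≢ _ (sym e))
  ...   | true | false = ⊥-elim (neg-≢ _ e)

  ⟦_⟧ : Window n → Code → Code
  ⟦ π ⟧ c = encode (app π (decode c))

  ⟦⟧-odd : ∀ π → Odd ⟦ π ⟧
  ⟦⟧-odd π c = begin
    encode (app π (decode (opp c)))  ≡⟨ cong (encode ∘ app π) (decode-opp c) ⟩
    encode (app π (neg (decode c)))  ≡⟨ cong encode (app-neg π (decode c)) ⟩
    encode (neg (app π (decode c)))  ≡⟨ encode-neg (app π (decode c)) ⟩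
    opp (⟦ π ⟧ c)                    ∎
    where open ≡-Reasoning

  ⟦⟧-∘B : ∀ u π c → ⟦ u ∘B π ⟧ c ≡ ⟦ u ⟧ (⟦ π ⟧ c)
  ⟦⟧-∘B u π c = trans (cong encode (app-∘B u π (decode c))) (cong (encode ∘ app u) (sym (decode-encode (app π (decode c)))))

  ⟦⟧-faithful : ∀ {π σ : Window n} → (∀ c → ⟦ π ⟧ c ≡ ⟦ σ ⟧ c) → π ≡ σ
  ⟦⟧-faithful {π} {σ} e = trans (sym (VP.tabulate∘lookup π)) (trans (VP.tabulate-cong same-entry) (VP.tabulate∘lookup σ))
    where
    same-entry : ∀ i → lookup π i ≡ lookup σ i
    same-entry i = encode-injective (begin
      encode (lookup π i)                           ≡⟨ cong (encode ∘ app π) (decode-encode (false , i)) ⟨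
      ⟦ π ⟧ (encode (false , i))                    ≡⟨ e (encode (false , i)) ⟩
      ⟦ σ ⟧ (encode (false , i))                    ≡⟨ cong (encode ∘ app σ) (decode-encode (false , i)) ⟩
      encode (lookup σ i)                           ∎)
      where open ≡-Reasoning

  signedPerm⇒injective : ∀ π → IsSignedPerm π → Injective ⟦ π ⟧
  signedPerm⇒injective π perm c d e =
    trans (sym (encode-decode c)) (trans (cong encode (app-injective π perm (decode c) (decode d) (encode-injective e))) (encode-decode d))

  ⟦win⟧ : ∀ (h : Letter n → Letter n) (H : Code → Code) → (∀ x → encode (h x) ≡ H (encode x)) → Odd H →
          ∀ c → ⟦ win h ⟧ c ≡ H c
  ⟦win⟧ h H h≈H odd c = trans (on-letters (decode c)) (cong H (encode-decode c))
    where
    on-letters : ∀ x → encode (app (win h) x) ≡ H (encode x)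
    on-letters (false , i) = trans (cong encode (VP.lookup∘tabulate (λ j → h (false , j)) i)) (h≈H (false , i))
    on-letters (true , i) = begin
      encode (neg (lookup (win h) i))  ≡⟨ cong (encode ∘ neg) (VP.lookup∘tabulate (λ j → h (false , j)) i) ⟩
      encode (neg (h (false , i)))     ≡⟨ encode-neg (h (false , i)) ⟩
      opp (encode (h (false , i)))     ≡⟨ cong opp (h≈H (false , i)) ⟩
      opp (H (encode (false , i)))     ≡⟨ odd (encode (false , i)) ⟨
      H (opp (encode (false , i)))     ≡⟨ cong H (encode-neg-false i) ⟨
      H (encode (true , i))            ∎
      where open ≡-Reasoning

  encode-tr : ∀ a b x → encode (tr a b x) ≡ swap (encode a) (encode b) (encode x)
  encode-tr a b x with x ≟L a
  ... | yes refl = sym (swap-left (encode x) (encode b))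
  ... | no x≢a with x ≟L b
  ...   | yes refl = sym (swap-right (encode a) (encode x))
  ...   | no x≢b = sym (swap-other (encode a) (encode b) (encode x) (x≢a ∘ encode-injective) (x≢b ∘ encode-injective))

  encode-uFun : ∀ a b x → encode (uFun a b x) ≡ signedSwap (encode a) (encode b) (encode x)
  encode-uFun a b x with b ≟L neg a
  ... | yes b≡ā = begin
    encode (tr a (neg a) x)                      ≡⟨ encode-tr a (neg a) x ⟩
    swap (encode a) (encode (neg a)) (encode x)  ≡⟨ cong (λ z → swap (encode a) (encode z) (encode x)) b≡ā ⟨
    swap (encode a) (encode b) (encode x)        ≡⟨ signedSwap-reflection (encode a) (encode b) (trans (cong encode b≡ā) (encode-neg a)) (encode x) ⟨
    signedSwap (encode a) (encode b) (encode x)  ∎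
    where open ≡-Reasoning
  ... | no b≢ā = begin
    encode (tr a b (tr (neg a) (neg b) x))                              ≡⟨ encode-tr a b (tr (neg a) (neg b) x) ⟩
    swap (encode a) (encode b) (encode (tr (neg a) (neg b) x))          ≡⟨ cong (swap (encode a) (encode b)) (encode-tr (neg a) (neg b) x) ⟩
    swap (encode a) (encode b) (swap (encode (neg a)) (encode (neg b)) (encode x))
      ≡⟨ cong (swap (encode a) (encode b)) (cong₂ (λ u v → swap u v (encode x)) (encode-neg a) (encode-neg b)) ⟩
    swap (encode a) (encode b) (swap (opp (encode a)) (opp (encode b)) (encode x))
      ≡⟨ cong (swap (encode a) (encode b)) (swap-comm (opp (encode a)) (opp (encode b)) (encode x)) ⟩
    swap (encode a) (encode b) (swap (opp (encode b)) (opp (encode a)) (encode x))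
      ≡⟨ signedSwap-double (encode a) (encode b) (λ e → b≢ā (encode-injective (trans e (sym (encode-neg a))))) (encode x) ⟨
    signedSwap (encode a) (encode b) (encode x)                         ∎
    where open ≡-Reasoning

  ⟦uB⟧ : ∀ a b c → ⟦ uB a b ⟧ c ≡ signedSwap (encode a) (encode b) c
  ⟦uB⟧ a b = ⟦win⟧ (uFun a b) (signedSwap (encode a) (encode b)) (encode-uFun a b) (signedSwap-odd (encode a) (encode b))

module Length (m : ℕ) where
  open Line (suc m)
  open Encoding (suc m)

  genLow genHigh : Fin (suc m) → Code
  genLow zero = encode (true , zero)
  genLow (suc j) = encode (false , F.inject₁ j)
  genHigh zero = encode (false , zero)
  genHigh (suc j) = encode (false , suc j)

  ⟦gen⟧ : ∀ k c → ⟦ gen k ⟧ c ≡ signedSwap (genLow k) (genHigh k) c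
  ⟦gen⟧ zero c = trans (⟦uB⟧ (false , zero) (true , zero) c) (signedSwap-comm (genHigh zero) (genLow zero) c)
  ⟦gen⟧ (suc j) c = ⟦uB⟧ (false , F.inject₁ j) (false , suc j) c

  toℕ-genLow : ∀ k → toℕ (genLow k) ≡ m + toℕ k
  toℕ-genLow zero = trans (toℕ-encode-true zero) (sym (+-identityʳ m))
  toℕ-genLow (suc j) = begin
    toℕ (encode (false , F.inject₁ j))  ≡⟨ toℕ-encode-false (F.inject₁ j) ⟩
    suc m + toℕ (F.inject₁ j)           ≡⟨ cong (suc m +_) (FP.toℕ-inject₁ j) ⟩
    suc m + toℕ j                       ≡⟨ +-suc m (toℕ j) ⟨
    m + suc (toℕ j)                     ∎
    where open ≡-Reasoning

  genHigh-adjacent : ∀ k → toℕ (genHigh k) ≡ suc (toℕ (genLow k))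
  genHigh-adjacent zero = trans (toℕ-encode-false zero) (trans (+-identityʳ (suc m)) (cong suc (sym (toℕ-encode-true zero))))
  genHigh-adjacent (suc j) = trans (toℕ-encode-false (suc j)) (cong suc (sym (toℕ-genLow (suc j))))

  genLow≢genHigh : ∀ k → genLow k ≢ genHigh k
  genLow≢genHigh k e = <-irrefl (cong toℕ e) (≤-reflexive (sym (genHigh-adjacent k)))

  gen-admissible : ∀ k → genHigh k ≡ opp (genLow k) ⊎ SameSide (genLow k) (genHigh k)
  gen-admissible zero = inj₁ (encode-neg (true , zero))
  gen-admissible (suc j) = inj₂ (inj₂ (subst (suc m ≤_) (sym (toℕ-encode-false (F.inject₁ j))) (m≤m+n (suc m) _) ,
                                       subst (suc m ≤_) (sym (toℕ-encode-false (suc j))) (m≤m+n (suc m) _)))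

  adjacent⇒gen : ∀ c d → m ≤ toℕ c → toℕ d ≡ suc (toℕ c) → ∃ λ k → genLow k ≡ c × genHigh k ≡ d
  adjacent⇒gen c d m≤c d≡1+c = k , low , FP.toℕ-injective (trans (genHigh-adjacent k) (trans (cong (suc ∘ toℕ) low) (sym d≡1+c)))
    where
    c∸m<1+m : toℕ c ∸ m < suc m
    c∸m<1+m = +-cancelˡ-< m (toℕ c ∸ m) (suc m)
                (subst (_< m + suc m) (sym (m+[n∸m]≡n m≤c)) (≤-pred (subst (_< suc m + suc m) d≡1+c (FP.toℕ<n d))))
    k : Fin (suc m)
    k = F.fromℕ< c∸m<1+m
    low : genLow k ≡ c
    low = FP.toℕ-injective (trans (toℕ-genLow k) (trans (cong (m +_) (FP.toℕ-fromℕ< c∸m<1+m)) (m+[n∸m]≡n m≤c)))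

  ⟦idB⟧ : ∀ c → ⟦ idB ⟧ c ≡ c
  ⟦idB⟧ = ⟦win⟧ (λ x → x) (λ c → c) (λ x → refl) (λ c → refl)

  ⟦gen∘B⟧ : ∀ k π c → ⟦ gen k ∘B π ⟧ c ≡ signedSwap (genLow k) (genHigh k) (⟦ π ⟧ c)
  ⟦gen∘B⟧ k π c = trans (⟦⟧-∘B (gen k) π c) (⟦gen⟧ k (⟦ π ⟧ c))

  gen∘B-injective : ∀ k π → Injective ⟦ π ⟧ → Injective ⟦ gen k ∘B π ⟧
  gen∘B-injective k π inj i j e =
    inj i j (signedSwap-injective (genLow k) (genHigh k) (trans (sym (⟦gen∘B⟧ k π i)) (trans e (⟦gen∘B⟧ k π j))))

  eval-injective : ∀ ws → Injective ⟦ eval ws ⟧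
  eval-injective [] i j e = trans (sym (⟦idB⟧ i)) (trans e (⟦idB⟧ j))
  eval-injective (k ∷ ks) = gen∘B-injective k (eval ks) (eval-injective ks)

  module GenSwap (π : Window (suc m)) (inj : Injective ⟦ π ⟧) (k : Fin (suc m)) =
    AdjacentSwap ⟦ π ⟧ inj (⟦⟧-odd π) (genLow k) (genHigh k)
                 (preimage ⟦ π ⟧ inj (genLow k)) (preimage ⟦ π ⟧ inj (genHigh k))
                 (preimage-spec ⟦ π ⟧ inj _) (preimage-spec ⟦ π ⟧ inj _) (genHigh-adjacent k) (gen-admissible k)

  twiceLength-eval-≤ : ∀ ws → twiceLength ⟦ eval ws ⟧ ≤ 2 * length ws
  twiceLength-eval-≤ [] = ≤-reflexive (trans (twiceLength-cong ⟦idB⟧) twiceLength-id)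
  twiceLength-eval-≤ (k ∷ ks) = begin
    twiceLength ⟦ eval (k ∷ ks) ⟧  ≡⟨ twiceLength-cong (⟦gen∘B⟧ k (eval ks)) ⟩
    twiceLength (λ c → signedSwap (genLow k) (genHigh k) (⟦ eval ks ⟧ c))
                                   ≤⟨ GenSwap.twiceLength-adjacent-≤ (eval ks) (eval-injective ks) k ⟩
    twiceLength ⟦ eval ks ⟧ + 2    ≤⟨ +-monoˡ-≤ 2 (twiceLength-eval-≤ ks) ⟩
    2 * length ks + 2              ≡⟨ solve-∀′ (length ks) ⟩
    2 * suc (length ks)            ∎
    where
    open ≤-Reasoning
    solve-∀′ : ∀ l → 2 * l + 2 ≡ 2 * suc l
    solve-∀′ = solve-∀

  twiceLength-gen-descent : ∀ π (inj : Injective ⟦ π ⟧) k →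
    toℕ (preimage ⟦ π ⟧ inj (genHigh k)) < toℕ (preimage ⟦ π ⟧ inj (genLow k)) →
    twiceLength ⟦ gen k ∘B π ⟧ + 2 ≡ twiceLength ⟦ π ⟧
  twiceLength-gen-descent π inj k descent with GenSwap.twiceLength-adjacent π inj k
  ... | inj₁ (_ , e) = trans (cong (_+ 2) (twiceLength-cong (⟦gen∘B⟧ k π))) e
  ... | inj₂ (ascent , _) = ⊥-elim (<-asym ascent descent)

  -- Without generator descents, the inverse of f increases across every adjacent pair, so f is the identity.
  module NoDescent (f : Code → Code) (inj : Injective f) (odd : Odd f)
                   (ascent : ∀ k → toℕ (preimage f inj (genLow k)) < toℕ (preimage f inj (genHigh k))) where

    g : Code → Code
    g = preimage f inj

    g-odd : Odd g
    g-odd v = inj _ _ (trans (preimage-spec f inj (opp v)) (sym (trans (odd (g v)) (cong opp (preimage-spec f inj v)))))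

    upper-step : ∀ c d → m ≤ toℕ c → toℕ d ≡ suc (toℕ c) → toℕ (g c) < toℕ (g d)
    upper-step c d m≤c d≡1+c with adjacent⇒gen c d m≤c d≡1+c
    ... | k , refl , refl = ascent k

    g-stepIncreasing : StepIncreasing g
    g-stepIncreasing c d d≡1+c with m ≤? toℕ c
    ... | yes m≤c = upper-step c d m≤c d≡1+c
    ... | no c≱m = subst₂ (λ u v → toℕ u < toℕ v) (opp-involutive (g c)) (opp-involutive (g d))
                     (opposite-reverses-< (subst₂ (λ u v → toℕ u < toℕ v) (g-odd d) (g-odd c)
                       (upper-step (opp d) (opp c) m≤d̄ (opposite-adjacent d≡1+c))))
      where
      m≤d̄ : m ≤ toℕ (opp d)
      m≤d̄ = +-cancelʳ-≤ (suc (toℕ d)) m (toℕ (opp d)) (begin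
        m + suc (toℕ d)            ≤⟨ +-monoʳ-≤ m (subst (_≤ suc m) (cong suc (sym d≡1+c)) (s≤s (≰⇒> c≱m))) ⟩
        m + suc m                  ≤⟨ m≤n+m (m + suc m) 1 ⟩
        suc m + suc m              ≡⟨ opposite-sum d ⟨
        toℕ (opp d) + suc (toℕ d)  ∎)
        where open ≤-Reasoning

    f≗id : ∀ c → f c ≡ c
    f≗id c = trans (cong f (sym (stepIncreasing⇒id g g-stepIncreasing c))) (preimage-spec f inj c)

  ReducedWord : Window (suc m) → Set
  ReducedWord π = ∃ λ ws → eval ws ≡ π × 2 * length ws ≡ twiceLength ⟦ π ⟧

  -- Peel off generator descents; the fuel N bounds twiceLength, which drops by 2 at each step.
  reducedWord-fuel : ∀ N π → Injective ⟦ π ⟧ → twiceLength ⟦ π ⟧ < N → ReducedWord π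
  reducedWord-fuel (suc N) π inj bound
    with FP.any? (λ k → toℕ (preimage ⟦ π ⟧ inj (genHigh k)) <? toℕ (preimage ⟦ π ⟧ inj (genLow k)))
  ... | yes (k , descent) with reducedWord-fuel N (gen k ∘B π) (gen∘B-injective k π inj) smaller
    where
    smaller : twiceLength ⟦ gen k ∘B π ⟧ < N
    smaller = ≤-pred (≤-trans (s≤s (≤-trans (n≤1+n _) (≤-reflexive (+-comm 2 _))))
                              (subst (_< suc N) (sym (twiceLength-gen-descent π inj k descent)) bound))
  ...   | ws , eval-ws , len-ws = k ∷ ws , ⟦⟧-faithful same , trans (solve-∀′ (length ws))
                                       (trans (cong (_+ 2) len-ws) (twiceLength-gen-descent π inj k descent))
    where
    solve-∀′ : ∀ l → 2 * suc l ≡ 2 * l + 2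
    solve-∀′ = solve-∀
    same : ∀ c → ⟦ gen k ∘B eval ws ⟧ c ≡ ⟦ π ⟧ c
    same c = begin
      ⟦ gen k ∘B eval ws ⟧ c  ≡⟨ ⟦gen∘B⟧ k (eval ws) c ⟩
      s (⟦ eval ws ⟧ c)        ≡⟨ cong (λ w → s (⟦ w ⟧ c)) eval-ws ⟩
      s (⟦ gen k ∘B π ⟧ c)     ≡⟨ cong s (⟦gen∘B⟧ k π c) ⟩
      s (s (⟦ π ⟧ c))          ≡⟨ signedSwap-involutive (genLow k) (genHigh k) (⟦ π ⟧ c) ⟩
      ⟦ π ⟧ c                  ∎
      where
      open ≡-Reasoning
      s : Code → Code
      s = signedSwap (genLow k) (genHigh k)
  reducedWord-fuel (suc N) π inj bound | no none =
    [] , sym (⟦⟧-faithful (λ c → trans (f≗id c) (sym (⟦idB⟧ c)))) , sym (trans (twiceLength-cong f≗id) twiceLength-id)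
    where
    ascent : ∀ k → toℕ (preimage ⟦ π ⟧ inj (genLow k)) < toℕ (preimage ⟦ π ⟧ inj (genHigh k))
    ascent k with <-cmp (toℕ (preimage ⟦ π ⟧ inj (genLow k))) (toℕ (preimage ⟦ π ⟧ inj (genHigh k)))
    ... | tri< lt _ _ = lt
    ... | tri≈ _ eq _ = ⊥-elim (genLow≢genHigh k (trans (sym (preimage-spec ⟦ π ⟧ inj _))
                                 (trans (cong ⟦ π ⟧ (FP.toℕ-injective eq)) (preimage-spec ⟦ π ⟧ inj _))))
    ... | tri> _ _ gt = ⊥-elim (none (k , gt))
    open NoDescent ⟦ π ⟧ inj (⟦⟧-odd π) ascent using (f≗id)

  reducedWord : ∀ π → Injective ⟦ π ⟧ → ReducedWord π
  reducedWord π inj = reducedWord-fuel (suc (twiceLength ⟦ π ⟧)) π inj (n<1+n _)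

  IsLength⇒twiceLength : ∀ π → Injective ⟦ π ⟧ → ∀ k → IsLength π k → twiceLength ⟦ π ⟧ ≡ 2 * k
  IsLength⇒twiceLength π inj k ((ws , len-ws , refl) , minimal) with reducedWord π inj
  ... | ws₀ , eval-ws₀ , len-ws₀ =
    ≤-antisym (≤-trans (twiceLength-eval-≤ ws) (≤-reflexive (cong (2 *_) len-ws)))
              (≤-trans (*-monoʳ-≤ 2 (minimal ws₀ eval-ws₀)) (≤-reflexive len-ws₀))

  twiceLength⇒IsLength : ∀ π → Injective ⟦ π ⟧ → ∀ k → twiceLength ⟦ π ⟧ ≡ 2 * k → IsLength π k
  twiceLength⇒IsLength π inj k e with reducedWord π inj
  ... | ws₀ , eval-ws₀ , len-ws₀ =
    (ws₀ , *-cancelˡ-≡ (length ws₀) k 2 (trans len-ws₀ e) , eval-ws₀) ,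
    (λ { ws refl → *-cancelˡ-≤ 2 (≤-trans (≤-reflexive (sym e)) (twiceLength-eval-≤ ws)) })

  twiceLength-even : ∀ π → Injective ⟦ π ⟧ → ∃ λ k → twiceLength ⟦ π ⟧ ≡ 2 * k
  twiceLength-even π inj with reducedWord π inj
  ... | ws₀ , _ , len-ws₀ = length ws₀ , sym len-ws₀

  ⟦uB∘B⟧ : ∀ a b π c → ⟦ uB a b ∘B π ⟧ c ≡ signedSwap (encode a) (encode b) (⟦ π ⟧ c)
  ⟦uB∘B⟧ a b π c = trans (⟦⟧-∘B (uB a b) π c) (⟦uB⟧ a b (⟦ π ⟧ c))

  uB∘B-injective : ∀ a b π → Injective ⟦ π ⟧ → Injective ⟦ uB a b ∘B π ⟧
  uB∘B-injective a b π inj i j e =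
    inj i j (signedSwap-injective (encode a) (encode b) (trans (sym (⟦uB∘B⟧ a b π i)) (trans e (⟦uB∘B⟧ a b π j))))

  strongDescent⇒drop : ∀ π → Injective ⟦ π ⟧ → ∀ w → InStrongDescB π w →
                       ∃ λ a → ∃ λ b → w ≡ uB a b × twiceLength ⟦ uB a b ∘B π ⟧ + 2 ≡ twiceLength ⟦ π ⟧
  strongDescent⇒drop π inj w (a , b , _ , _ , refl , k , length-π , length-uπ) = a , b , refl , (begin
    twiceLength ⟦ uB a b ∘B π ⟧ + 2  ≡⟨ cong (_+ 2) (IsLength⇒twiceLength (uB a b ∘B π) (uB∘B-injective a b π inj) k length-uπ) ⟩
    2 * k + 2                        ≡⟨ solve-∀′ k ⟩
    2 * suc k                        ≡⟨ IsLength⇒twiceLength π inj (suc k) length-π ⟨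
    twiceLength ⟦ π ⟧                ∎)
    where
    open ≡-Reasoning
    solve-∀′ : ∀ k → 2 * k + 2 ≡ 2 * suc k
    solve-∀′ = solve-∀

  drop⇒strongDescent : ∀ π → Injective ⟦ π ⟧ → ∀ a b → a ≢ b → UDefined π a b →
                       twiceLength ⟦ uB a b ∘B π ⟧ + 2 ≡ twiceLength ⟦ π ⟧ → InStrongDescB π (uB a b)
  drop⇒strongDescent π inj a b a≢b defined drop =
    a , b , a≢b , defined , refl , k ,
    twiceLength⇒IsLength π inj (suc k) (trans (sym drop) (trans (cong (_+ 2) even) (solve-∀′ k))) ,
    twiceLength⇒IsLength (uB a b ∘B π) uπ-injective k even
    where
    uπ-injective : Injective ⟦ uB a b ∘B π ⟧
    uπ-injective = uB∘B-injective a b π inj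
    k : ℕ
    k = proj₁ (twiceLength-even (uB a b ∘B π) uπ-injective)
    even : twiceLength ⟦ uB a b ∘B π ⟧ ≡ 2 * k
    even = proj₂ (twiceLength-even (uB a b ∘B π) uπ-injective)
    solve-∀′ : ∀ k → 2 * k + 2 ≡ 2 * suc k
    solve-∀′ = solve-∀

module Transfer (n : ℕ) where
  open Line n

  magnitude : Code → ℕ
  magnitude c = toℕ c ⊔ toℕ (opp c)

  magnitude-opp : ∀ c → magnitude (opp c) ≡ magnitude c
  magnitude-opp c = trans (cong (toℕ (opp c) ⊔_) (cong toℕ (opp-involutive c))) (⊔-comm (toℕ (opp c)) (toℕ c))

  magnitude-negative : ∀ c → toℕ c < n → magnitude c ≡ toℕ (opp c)
  magnitude-negative c c<n = m≤n⇒m⊔n≡n (<⇒≤ (<-≤-trans c<n (opp-negative c c<n)))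

  magnitude-positive : ∀ c → n ≤ toℕ c → magnitude c ≡ toℕ c
  magnitude-positive c n≤c = m≥n⇒m⊔n≡m (<⇒≤ (<-≤-trans (opp-positive c n≤c) n≤c))

  magnitude-between : ∀ {x z y} → toℕ x < toℕ z → toℕ z < toℕ y → magnitude z ≤ magnitude x ⊔ magnitude y
  magnitude-between {x} {z} {y} x<z z<y =
    ⊔-lub (≤-trans (<⇒≤ z<y) (≤-trans (m≤m⊔n (toℕ y) (toℕ (opp y))) (m≤n⊔m (magnitude x) (magnitude y))))
          (≤-trans (<⇒≤ (opposite-reverses-< x<z)) (≤-trans (m≤n⊔m (toℕ x) (toℕ (opp x))) (m≤m⊔n (magnitude x) (magnitude y))))

  magnitude-between′ : ∀ {x z y} → toℕ x < toℕ z → toℕ z < toℕ y → magnitude z ≤ magnitude y ⊔ magnitude x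
  magnitude-between′ {x} {z} {y} x<z z<y = ≤-trans (magnitude-between x<z z<y) (≤-reflexive (⊔-comm (magnitude x) (magnitude y)))

  -- Induction measure for an inversion: values x < y at positions p > q.  The box always shrinks in `width`,
  -- except when passing to the pairs (x, -x) and (-y, y), where `spread` drops instead.
  widthBound : ℕ
  widthBound = 4 * (n + n)

  spread width measure : Code → Code → Code → Code → ℕ
  spread x y p q = (magnitude x ⊔ magnitude y) + (magnitude p ⊔ magnitude q)
  width x y p q = toℕ y + toℕ p + toℕ (opp x) + toℕ (opp q)
  measure x y p q = spread x y p q * widthBound + width x y p q

  width<widthBound : ∀ x y p q → width x y p q < widthBound
  width<widthBound x y p q =
    ≤-trans (+-mono-≤ (+-mono-≤ (+-mono-≤ (FP.toℕ<n y) (<⇒≤ (FP.toℕ<n p))) (<⇒≤ (FP.toℕ<n (opp x)))) (<⇒≤ (FP.toℕ<n (opp q))))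
            (≤-reflexive (solve-∀′ (n + n)))
    where
    solve-∀′ : ∀ t → t + t + t + t ≡ 4 * t
    solve-∀′ = solve-∀

  lex-≤-< : ∀ {a a′ s s′} → a′ ≤ a → s′ < s → a′ * widthBound + s′ < a * widthBound + s
  lex-≤-< a′≤a s′<s = +-mono-≤-< (*-monoˡ-≤ widthBound a′≤a) s′<s

  lex-< : ∀ {a a′ s s′} → a′ < a → s′ < widthBound → a′ * widthBound + s′ < a * widthBound + s
  lex-< {a} {a′} {s} {s′} a′<a s′<K = begin-strict
    a′ * widthBound + s′          <⟨ +-monoʳ-< (a′ * widthBound) s′<K ⟩
    a′ * widthBound + widthBound  ≡⟨ +-comm (a′ * widthBound) widthBound ⟩
    suc a′ * widthBound           ≤⟨ *-monoˡ-≤ widthBound a′<a ⟩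
    a * widthBound                ≤⟨ m≤m+n (a * widthBound) s ⟩
    a * widthBound + s            ∎
    where open ≤-Reasoning

  InvertedBy : (Code → Code) → Code → Code → Set
  InvertedBy h x y = ∀ p′ q′ → h p′ ≡ x → h q′ ≡ y → toℕ q′ < toℕ p′

  module Closure (f h : Code → Code) (inj-h : Injective h) (odd-f : Odd f) (odd-h : Odd h)
                 (covers : ∀ x y p q → toℕ x < toℕ y → f p ≡ x → f q ≡ y → toℕ q < toℕ p →
                           Covering f x y p q → Admissible x y p q → InvertedBy h x y) where

    InvertedBelow : ℕ → Set
    InvertedBelow N = ∀ x y p q → measure x y p q < N →
                      toℕ x < toℕ y → f p ≡ x → f q ≡ y → toℕ q < toℕ p → InvertedBy h x y

    module Step (N : ℕ) (ih : InvertedBelow N) (x y p q : Code) (bound : measure x y p q ≤ N)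
                (x<y : toℕ x < toℕ y) (fp≡x : f p ≡ x) (fq≡y : f q ≡ y) (q<p : toℕ q < toℕ p) where

      split : ∀ k → toℕ q < toℕ k → toℕ k < toℕ p → toℕ x < toℕ (f k) → toℕ (f k) < toℕ y → InvertedBy h x y
      split k q<k k<p x<z z<y p′ q′ hp′≡x hq′≡y =
        <-trans (ih z y k q lower-smaller z<y refl fq≡y q<k k′ q′ hk′≡z hq′≡y)
                (ih x z p k upper-smaller x<z fp≡x refl k<p p′ k′ hp′≡x hk′≡z)
        where
        z k′ : Code
        z = f k
        k′ = preimage h inj-h z
        hk′≡z : h k′ ≡ z
        hk′≡z = preimage-spec h inj-h z
        upper-smaller : measure x z p k < N
        upper-smaller = <-≤-trans (lex-≤-<
          (+-mono-≤ (⊔-lub (m≤m⊔n (magnitude x) (magnitude y)) (magnitude-between x<z z<y))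
                    (⊔-lub (m≤m⊔n (magnitude p) (magnitude q)) (magnitude-between′ q<k k<p)))
          (+-mono-<-≤ (+-mono-<-≤ (+-mono-<-≤ z<y (≤-refl {toℕ p})) (≤-refl {toℕ (opp x)})) (<⇒≤ (opposite-reverses-< q<k))))
          bound
        lower-smaller : measure z y k q < N
        lower-smaller = <-≤-trans (lex-≤-<
          (+-mono-≤ (⊔-lub (magnitude-between x<z z<y) (m≤n⊔m (magnitude x) (magnitude y)))
                    (⊔-lub (magnitude-between′ q<k k<p) (m≤n⊔m (magnitude p) (magnitude q))))
          (+-mono-<-≤ (+-mono-<-≤ (+-mono-≤-< (≤-refl {toℕ y}) k<p) (<⇒≤ (opposite-reverses-< x<z))) (≤-refl {toℕ (opp q)})))
          bound

      module Straddle (cov : Covering f x y p q) (y≢x̄ : y ≢ opp x) (x<n : toℕ x < n) (n≤y : n ≤ toℕ y)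
                      (n≤p : n ≤ toℕ p) (q<n : toℕ q < n) where

        x<x̄ : toℕ x < toℕ (opp x)
        x<x̄ = <-≤-trans x<n (opp-negative x x<n)

        p̄<p : toℕ (opp p) < toℕ p
        p̄<p = <-≤-trans (opp-positive p n≤p) n≤p

        ȳ<y : toℕ (opp y) < toℕ y
        ȳ<y = <-≤-trans (opp-positive y n≤y) n≤y

        q<q̄ : toℕ q < toℕ (opp q)
        q<q̄ = <-≤-trans q<n (opp-negative q q<n)

        fp̄≡x̄ : f (opp p) ≡ opp x
        fp̄≡x̄ = trans (odd-f p) (cong opp fp≡x)

        fq̄≡ȳ : f (opp q) ≡ opp y
        fq̄≡ȳ = trans (odd-f q) (cong opp fq≡y)

        magnitude-self-opp : ∀ c → magnitude c ⊔ magnitude (opp c) ≡ magnitude c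
        magnitude-self-opp c = trans (cong (magnitude c ⊔_) (magnitude-opp c)) (⊔-idem (magnitude c))

        spread-x : spread x (opp x) p (opp p) ≡ toℕ (opp x) + toℕ p
        spread-x = cong₂ _+_ (trans (magnitude-self-opp x) (magnitude-negative x x<n))
                             (trans (magnitude-self-opp p) (magnitude-positive p n≤p))

        spread-y : spread (opp y) y (opp q) q ≡ toℕ y + toℕ (opp q)
        spread-y = cong₂ _+_ (trans (⊔-comm (magnitude (opp y)) (magnitude y)) (trans (magnitude-self-opp y) (magnitude-positive y n≤y)))
                             (trans (⊔-comm (magnitude (opp q)) (magnitude q)) (trans (magnitude-self-opp q) (magnitude-negative q q<n)))

        spread-xyqp : spread x y p q ≡ (toℕ (opp x) ⊔ toℕ y) + (toℕ p ⊔ toℕ (opp q))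
        spread-xyqp = cong₂ _+_ (cong₂ _⊔_ (magnitude-negative x x<n) (magnitude-positive y n≤y))
                                (cong₂ _⊔_ (magnitude-positive p n≤p) (magnitude-negative q q<n))

        p̄<q : toℕ (opp x) < toℕ y → toℕ (opp p) < toℕ q
        p̄<q x̄<y with <-cmp (toℕ (opp p)) (toℕ q)
        ... | tri< lt _ _ = lt
        ... | tri≈ _ eq _ = ⊥-elim (y≢x̄ (trans (sym fq≡y) (trans (cong f (sym (FP.toℕ-injective eq))) fp̄≡x̄)))
        ... | tri> _ _ gt = ⊥-elim (cov (opp p) gt p̄<p (subst (λ u → toℕ x < toℕ u) (sym fp̄≡x̄) x<x̄)
                                                     (subst (λ u → toℕ u < toℕ y) (sym fp̄≡x̄) x̄<y))

        p<q̄ : toℕ y < toℕ (opp x) → toℕ p < toℕ (opp q)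
        p<q̄ y<x̄ with <-cmp (toℕ p) (toℕ (opp q))
        ... | tri< lt _ _ = lt
        ... | tri≈ _ eq _ = ⊥-elim (≢opp-sym y≢x̄ (trans (sym fp≡x) (trans (cong f (FP.toℕ-injective eq)) fq̄≡ȳ)))
        ... | tri> _ _ gt = ⊥-elim (cov (opp q) q<q̄ gt (subst (λ u → toℕ x < toℕ u) (sym fq̄≡ȳ) (opp-flipˡ y<x̄))
                                                     (subst (λ u → toℕ u < toℕ y) (sym fq̄≡ȳ) ȳ<y))

        spreads-smaller : toℕ (opp x) + toℕ p < spread x y p q × toℕ y + toℕ (opp q) < spread x y p q
        spreads-smaller rewrite spread-xyqp with <-cmp (toℕ (opp x)) (toℕ y)
        ... | tri< x̄<y _ _ rewrite m≤n⇒m⊔n≡n (<⇒≤ x̄<y) | m≥n⇒m⊔n≡m (<⇒≤ (opp-flipʳ (p̄<q x̄<y))) =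
              +-monoˡ-< (toℕ p) x̄<y , +-monoʳ-< (toℕ y) (opp-flipʳ (p̄<q x̄<y))
        ... | tri≈ _ eq _ = ⊥-elim (y≢x̄ (FP.toℕ-injective (sym eq)))
        ... | tri> _ _ y<x̄ rewrite m≥n⇒m⊔n≡m (<⇒≤ y<x̄) | m≤n⇒m⊔n≡n (<⇒≤ (p<q̄ y<x̄)) =
              +-monoʳ-< (toℕ (opp x)) (p<q̄ y<x̄) , +-monoˡ-< (toℕ (opp q)) y<x̄

        inverted : InvertedBy h x y
        inverted p′ q′ hp′≡x hq′≡y = <-≤-trans q′<n n≤p′
          where
          p̄′<p′ : toℕ (opp p′) < toℕ p′
          p̄′<p′ = ih x (opp x) p (opp p)
                     (<-≤-trans (lex-< (subst (_< spread x y p q) (sym spread-x) (proj₁ spreads-smaller)) (width<widthBound x (opp x) p (opp p))) bound)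
                     x<x̄ fp≡x fp̄≡x̄ p̄<p p′ (opp p′) hp′≡x (trans (odd-h p′) (cong opp hp′≡x))
          q′<q̄′ : toℕ q′ < toℕ (opp q′)
          q′<q̄′ = ih (opp y) y (opp q) q
                     (<-≤-trans (lex-< (subst (_< spread x y p q) (sym spread-y) (proj₂ spreads-smaller)) (width<widthBound (opp y) y (opp q) q)) bound)
                     ȳ<y fq̄≡ȳ fq≡y q<q̄ (opp q′) q′ (trans (odd-h q′) (cong opp hq′≡y)) hq′≡y
          n≤p′ : n ≤ toℕ p′
          n≤p′ with toℕ p′ <? n
          ... | yes p′<n = ⊥-elim (<-asym p̄′<p′ (<-≤-trans p′<n (opp-negative p′ p′<n)))
          ... | no p′≮n = ≮⇒≥ p′≮n
          q′<n : toℕ q′ < n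
          q′<n with toℕ q′ <? n
          ... | yes q′<n = q′<n
          ... | no q′≮n = ⊥-elim (<-asym q′<q̄′ (<-≤-trans (opp-positive q′ (≮⇒≥ q′≮n)) (≮⇒≥ q′≮n)))

      covered : Covering f x y p q → InvertedBy h x y
      covered cov = go (y F.≟ opp x) (toℕ x <? n) (toℕ y <? n) (toℕ p <? n) (toℕ q <? n)
        where
        admissible : Admissible x y p q → InvertedBy h x y
        admissible = covers x y p q x<y fp≡x fq≡y q<p cov
        go : Dec (y ≡ opp x) → Dec (toℕ x < n) → Dec (toℕ y < n) → Dec (toℕ p < n) → Dec (toℕ q < n) → InvertedBy h x y
        go (yes y≡x̄) _ _ _ _ = admissible (inj₁ y≡x̄)
        go (no _) (yes x<n) (yes y<n) _ _ = admissible (inj₂ (inj₁ (inj₁ (x<n , y<n))))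
        go (no _) (no x≮n) (no y≮n) _ _ = admissible (inj₂ (inj₁ (inj₂ (≮⇒≥ x≮n , ≮⇒≥ y≮n))))
        go (no _) (no x≮n) (yes y<n) _ _ = ⊥-elim (x≮n (<-trans x<y y<n))
        go (no _) (yes _) (no _) (yes p<n) (yes q<n) = admissible (inj₂ (inj₂ (inj₁ (p<n , q<n))))
        go (no _) (yes _) (no _) (no p≮n) (no q≮n) = admissible (inj₂ (inj₂ (inj₂ (≮⇒≥ p≮n , ≮⇒≥ q≮n))))
        go (no _) (yes _) (no _) (yes p<n) (no q≮n) = ⊥-elim (q≮n (<-trans q<p p<n))
        go (no y≢x̄) (yes x<n) (no y≮n) (no p≮n) (yes q<n) = Straddle.inverted cov y≢x̄ x<n (≮⇒≥ y≮n) (≮⇒≥ p≮n) q<n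

    inverted : ∀ N → InvertedBelow N
    inverted zero _ _ _ _ ()
    inverted (suc N) x y p q (s≤s bound) x<y fp≡x fq≡y q<p
      with FP.any? (λ k → (toℕ q <? toℕ k) ×-dec ((toℕ k <? toℕ p) ×-dec ((toℕ x <? toℕ (f k)) ×-dec (toℕ (f k) <? toℕ y))))
    ... | yes (k , q<k , k<p , x<fk , fk<y) = Step.split N (inverted N) x y p q bound x<y fp≡x fq≡y q<p k q<k k<p x<fk fk<y
    ... | no empty = Step.covered N (inverted N) x y p q bound x<y fp≡x fq≡y q<p (λ k q<k k<p x<fk fk<y → empty (k , q<k , k<p , x<fk , fk<y))

    inversions-transfer : ∀ x y p q → toℕ x < toℕ y → f p ≡ x → f q ≡ y → toℕ q < toℕ p → InvertedBy h x y
    inversions-transfer x y p q = inverted (suc (measure x y p q)) x y p q ≤-refl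

module Injectivity (m : ℕ) where
  open Line (suc m)
  open Encoding (suc m)
  open Length m
  open Transfer (suc m)

  ⟦uB-decode⟧ : ∀ x y c → ⟦ uB (decode x) (decode y) ⟧ c ≡ signedSwap x y c
  ⟦uB-decode⟧ x y c = trans (⟦uB⟧ (decode x) (decode y) c) (cong₂ (λ u v → signedSwap u v c) (encode-decode x) (encode-decode y))

  admissible⇒defined : ∀ π {x y p q} → ⟦ π ⟧ p ≡ x → ⟦ π ⟧ q ≡ y → Admissible x y p q → UDefined π (decode x) (decode y)
  admissible⇒defined π {x} {y} _ _ (inj₁ y≡x̄) =
    inj₁ (sym (trans (sym (decode-opp y)) (cong decode (trans (cong opp y≡x̄) (opp-involutive x)))))
  admissible⇒defined π _ _ (inj₂ (inj₁ ss)) = inj₂ (inj₁ (sameSide⇒sgn≡ ss))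
  admissible⇒defined π {p = p} {q} πp≡x πq≡y (inj₂ (inj₂ sp)) =
    inj₂ (inj₂ (decode p , decode q , on-letters p πp≡x , on-letters q πq≡y , sameSide⇒sgn≡ sp))
    where
    on-letters : ∀ k {v} → ⟦ π ⟧ k ≡ v → app π (decode k) ≡ decode v
    on-letters k e = trans (sym (decode-encode (app π (decode k)))) (cong decode e)

  twiceLength-uB-decode∘B : ∀ x y π → twiceLength ⟦ uB (decode x) (decode y) ∘B π ⟧ ≡ twiceLength (λ c → signedSwap x y (⟦ π ⟧ c))
  twiceLength-uB-decode∘B x y π = twiceLength-cong (λ c → trans (⟦⟧-∘B (uB (decode x) (decode y)) π c) (⟦uB-decode⟧ x y (⟦ π ⟧ c)))

  covering⇒strongDescent : ∀ π → Injective ⟦ π ⟧ → ∀ x y p q → toℕ x < toℕ y → ⟦ π ⟧ p ≡ x → ⟦ π ⟧ q ≡ y → toℕ q < toℕ p →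
                           Covering ⟦ π ⟧ x y p q → Admissible x y p q → InStrongDescB π (uB (decode x) (decode y))
  covering⇒strongDescent π inj x y p q x<y πp≡x πq≡y q<p cov adm =
    drop⇒strongDescent π inj (decode x) (decode y) decode-x≢decode-y (admissible⇒defined π πp≡x πq≡y adm)
      (trans (cong (_+ 2) (twiceLength-uB-decode∘B x y π))
             (SignedSwapDrop.twiceLength-drop-exact ⟦ π ⟧ inj (⟦⟧-odd π) x y p q x<y πp≡x πq≡y q<p cov adm))
    where
    decode-x≢decode-y : decode x ≢ decode y
    decode-x≢decode-y e = <-irrefl (cong toℕ (trans (sym (encode-decode x)) (trans (cong encode e) (encode-decode y)))) x<y

  strongDescent⇒signedSwap-drop : ∀ σ → Injective ⟦ σ ⟧ → ∀ x y → InStrongDescB σ (uB (decode x) (decode y)) →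
                                  twiceLength (λ c → signedSwap x y (⟦ σ ⟧ c)) + 2 ≡ twiceLength ⟦ σ ⟧
  strongDescent⇒signedSwap-drop σ inj x y descent = trans (cong (_+ 2) (twiceLength-cong same-action)) drop
    where
    witness : ∃ λ a → ∃ λ b → uB (decode x) (decode y) ≡ uB a b × twiceLength ⟦ uB a b ∘B σ ⟧ + 2 ≡ twiceLength ⟦ σ ⟧
    witness = strongDescent⇒drop σ inj (uB (decode x) (decode y)) descent
    a b : Letter (suc m)
    a = proj₁ witness
    b = proj₁ (proj₂ witness)
    same-u : uB (decode x) (decode y) ≡ uB a b
    same-u = proj₁ (proj₂ (proj₂ witness))
    drop : twiceLength ⟦ uB a b ∘B σ ⟧ + 2 ≡ twiceLength ⟦ σ ⟧
    drop = proj₂ (proj₂ (proj₂ witness))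
    same-action : ∀ c → signedSwap x y (⟦ σ ⟧ c) ≡ ⟦ uB a b ∘B σ ⟧ c
    same-action c = trans (sym (⟦uB-decode⟧ x y (⟦ σ ⟧ c)))
                          (trans (cong (λ w → ⟦ w ⟧ (⟦ σ ⟧ c)) same-u) (sym (⟦⟧-∘B (uB a b) σ c)))

  -- Were x, y in order in h, undoing the signed swap would shorten h by one a second time.
  signedSwap-drop⇒inverted : ∀ h → Injective h → Odd h → ∀ x y → toℕ x < toℕ y →
                             twiceLength (λ c → signedSwap x y (h c)) + 2 ≡ twiceLength h → InvertedBy h x y
  signedSwap-drop⇒inverted h inj odd x y x<y drop p′ q′ hp′≡x hq′≡y with <-cmp (toℕ q′) (toℕ p′)
  ... | tri< q′<p′ _ _ = q′<p′
  ... | tri≈ _ q′≡p′ _ = ⊥-elim (<-irrefl (cong toℕ (trans (sym hp′≡x) (trans (cong h (FP.toℕ-injective (sym q′≡p′))) hq′≡y))) x<y)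
  ... | tri> _ _ p′<q′ = ⊥-elim (m+1+n≰m (twiceLength h′) (subst (_≤ twiceLength h′) (+-assoc (twiceLength h′) 2 2) (begin
    twiceLength h′ + 2 + 2                     ≡⟨ cong (_+ 2) drop ⟩
    twiceLength h + 2                          ≡⟨ cong (_+ 2) (twiceLength-cong (λ c → signedSwap-involutive x y (h c))) ⟨
    twiceLength (λ c → signedSwap x y (h′ c)) + 2
      ≤⟨ SignedSwapDrop.twiceLength-drop h′ (λ i j e → inj i j (signedSwap-injective x y e))
           (λ c → trans (cong (signedSwap x y) (odd c)) (signedSwap-odd x y (h c))) x y q′ p′ x<y
           (trans (cong (signedSwap x y) hq′≡y) (signedSwap-right x y)) (trans (cong (signedSwap x y) hp′≡x) (signedSwap-left x y)) p′<q′ ⟩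
    twiceLength h′                             ∎)))
    where
    open ≤-Reasoning
    h′ : Code → Code
    h′ c = signedSwap x y (h c)

  covers-inverted : ∀ π σ → Injective ⟦ π ⟧ → Injective ⟦ σ ⟧ → (∀ w → InStrongDescB π w → InStrongDescB σ w) →
                    ∀ x y p q → toℕ x < toℕ y → ⟦ π ⟧ p ≡ x → ⟦ π ⟧ q ≡ y → toℕ q < toℕ p →
                    Covering ⟦ π ⟧ x y p q → Admissible x y p q → InvertedBy ⟦ σ ⟧ x y
  covers-inverted π σ inj-π inj-σ D⊆D x y p q x<y πp≡x πq≡y q<p cov adm =
    signedSwap-drop⇒inverted ⟦ σ ⟧ inj-σ (⟦⟧-odd σ) x y x<y (strongDescent⇒signedSwap-drop σ inj-σ x y
      (D⊆D (uB (decode x) (decode y)) (covering⇒strongDescent π inj-π x y p q x<y πp≡x πq≡y q<p cov adm)))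

  SameStrongDescents : Window (suc m) → Window (suc m) → Set
  SameStrongDescents π σ = ∀ w → (InStrongDescB π w → InStrongDescB σ w) × (InStrongDescB σ w → InStrongDescB π w)

  -- Both ⟦ π ⟧ and ⟦ σ ⟧ have the same inversions, so σ⁻¹π keeps every pair of codes in order.
  sameStrongDescents⇒≡ : ∀ π σ → IsSignedPerm π → IsSignedPerm σ → SameStrongDescents π σ → π ≡ σ
  sameStrongDescents⇒≡ π σ perm-π perm-σ same = ⟦⟧-faithful (λ c → trans (sym (hg≡f c)) (cong h (stepIncreasing⇒id g g-stepIncreasing c)))
    where
    f h g : Code → Code
    f = ⟦ π ⟧
    h = ⟦ σ ⟧
    inj-f : Injective f
    inj-f = signedPerm⇒injective π perm-π
    inj-h : Injective h
    inj-h = signedPerm⇒injective σ perm-σ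
    g c = preimage h inj-h (f c)
    hg≡f : ∀ c → h (g c) ≡ f c
    hg≡f c = preimage-spec h inj-h (f c)
    open Closure f h inj-h (⟦⟧-odd π) (⟦⟧-odd σ) (covers-inverted π σ inj-f inj-h (proj₁ ∘ same))
      renaming (inversions-transfer to π-inversions⇒σ-inversions)
    open Closure h f inj-f (⟦⟧-odd σ) (⟦⟧-odd π) (covers-inverted σ π inj-h inj-f (proj₂ ∘ same))
      renaming (inversions-transfer to σ-inversions⇒π-inversions)
    g-stepIncreasing : StepIncreasing g
    g-stepIncreasing c d d≡1+c with <-cmp (toℕ (f c)) (toℕ (f d))
    ... | tri< fc<fd _ _ with <-cmp (toℕ (g c)) (toℕ (g d))
    ...   | tri< gc<gd _ _ = gc<gd
    ...   | tri≈ _ gc≡gd _ = ⊥-elim (<-irrefl (cong toℕ (trans (sym (hg≡f c)) (trans (cong h (FP.toℕ-injective gc≡gd)) (hg≡f d)))) fc<fd)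
    ...   | tri> _ _ gd<gc = ⊥-elim (<-asym (≤-reflexive (sym d≡1+c))
                                   (σ-inversions⇒π-inversions (f c) (f d) (g c) (g d) fc<fd (hg≡f c) (hg≡f d) gd<gc c d refl refl))
    g-stepIncreasing c d d≡1+c | tri≈ _ fc≡fd _ = ⊥-elim (<-irrefl (cong toℕ (inj-f c d (FP.toℕ-injective fc≡fd))) (≤-reflexive (sym d≡1+c)))
    g-stepIncreasing c d d≡1+c | tri> _ _ fd<fc =
      π-inversions⇒σ-inversions (f d) (f c) d c fd<fc refl refl (≤-reflexive (sym d≡1+c)) (g d) (g c) (hg≡f d) (hg≡f c)

mainTheorem1 : ∀ (n : ℕ) → 1 ≤ n → (π σ : Window n) → IsSignedPerm π → IsSignedPerm σ
    → (∀ (w : Window n) → (InStrongDescB π w → InStrongDescB σ w) × (InStrongDescB σ w → InStrongDescB π w))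
    → π ≡ σ
mainTheorem1 (suc m) _ = Injectivity.sameStrongDescents⇒≡ m
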